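{- Let $\mathcal N$ be a stack-free orchard network on $X$, and let $\{a,b\}$ be a cherry or a reticulated cherry of $\mathcal N$ (with $b$ the reticulation leaf in the latter case). If $\mathcal N'$ is obtained from $\mathcal N$ by reducing $b$ when $\{a,b\}$ is a cherry, or by cutting $\{a,b\}$ when $\{a,b\}$ is a reticulated cherry, then $\mathcal N'$ is a stack-free orchard network.
   Context: A phylogenetic network on a non-empty finite set $X$ is a rooted acyclic directed graph with no parallel arcs such that: (i) the unique root has in-degree $0$ and out-degree $2$; (ii) every vertex of out-degree $0$ has in-degree $1$, and the set of vertices of out-degree $0$ (the leaves) is $X$; (iii) every other vertex either has in-degree $1$ and out-degree $2$ (a tree vertex) or in-degree at least $2$ and out-degree $1$ (a reticulation). If $|X|=1$, a single vertex is also allowed. If $(u,v)$ is an arc, $u$ is a parent of $v$. A 2-element subset $\{a,b\}\subseteq X$ with parents $p_a,p_b$ is a cherry if $p_a=p_b$; it is a reticulated cherry with reticulation leaf $b$ if $p_b$ is a reticulation and $(p_a,p_b)$ is an arc. Reducing $b$ in a cherry: delete $b$ and suppress the resulting in-degree-1 out-degree-1 vertex (if the common parent is the root, delete $b$ and the root, leaving the single vertex $a$). Cutting a reticulated cherry $\{a,b\}$: delete the arc $(p_a,p_b)$ and suppress any resulting in-degree-1 out-degree-1 vertices. A phylogenetic network is orchard if some sequence of these cherry reductions transforms it into a single vertex. A stack is a pair of reticulations $u,v$ such that $(u,v)$ is an arc; a network is stack-free if it has no stacks. -}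

module Defs where

open import Data.Nat using (ℕ; _≤_; _≟_)
open import Data.Nat.Properties using ()
open import Data.Product using (_×_; _,_; proj₁; proj₂; Σ; ∃; ∃-syntax)
open import Data.Product.Properties using (≡-dec)
open import Data.Sum using (_⊎_)
open import Data.List using (List; []; _∷_; [_]; filter; length; _++_)
open import Data.List.Membership.Propositional using (_∈_)
open import Data.List.Relation.Unary.Unique.Propositional using (Unique)
open import Relation.Binary.PropositionalEquality using (_≡_; _≢_)
open import Relation.Nullary using (¬_; yes; no; ¬?)
open import Relation.Binary using (DecidableEquality)

-- Arcs are given as a list of ordered pairs (u , v) meaning u → v.
-- Leaf labels are the vertex labels themselves, so the leaf set X of a
-- network is the set of its out-degree-0 vertices.
record Graph : Set where
  constructor mkGraph
  field
    vertices : List ℕ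
    arcs     : List (ℕ × ℕ)
open Graph public

Arc : Set
Arc = ℕ × ℕ

_≟ₐ_ : DecidableEquality Arc
_≟ₐ_ = ≡-dec _≟_ _≟_

inArcs : Graph → ℕ → List Arc
inArcs G v = filter (λ e → proj₂ e ≟ v) (arcs G)

outArcs : Graph → ℕ → List Arc
outArcs G v = filter (λ e → proj₁ e ≟ v) (arcs G)

indeg : Graph → ℕ → ℕ
indeg G v = length (inArcs G v)

outdeg : Graph → ℕ → ℕ
outdeg G v = length (outArcs G v)

data Path⁺ (G : Graph) : ℕ → ℕ → Set where
  edge : ∀ {u v} → (u , v) ∈ arcs G → Path⁺ G u v
  step : ∀ {u w v} → (u , w) ∈ arcs G → Path⁺ G w v → Path⁺ G u v

Acyclic : Graph → Set
Acyclic G = ∀ v → ¬ Path⁺ G v v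

SingleVertex : Graph → Set
SingleVertex G = Σ ℕ λ x → (vertices G ≡ [ x ]) × (arcs G ≡ [])

IsReticulation : Graph → ℕ → Set
IsReticulation G v = (2 ≤ indeg G v) × (outdeg G v ≡ 1)

IsTreeVertex : Graph → ℕ → Set
IsTreeVertex G v = (indeg G v ≡ 1) × (outdeg G v ≡ 2)

IsLeafDeg : Graph → ℕ → Set
IsLeafDeg G v = (outdeg G v ≡ 0) × (indeg G v ≡ 1)

-- A phylogenetic network (on the set X of its out-degree-0 vertices).
-- "No parallel arcs" = the arc list has no duplicates.
IsNetwork : Graph → Set
IsNetwork G =
  SingleVertex G ⊎
  ( Unique (vertices G)
  × Unique (arcs G)
  × (∀ u v → (u , v) ∈ arcs G → (u ∈ vertices G) × (v ∈ vertices G))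
  × Acyclic G
  × Σ ℕ (λ r →
        (r ∈ vertices G) × (indeg G r ≡ 0) × (outdeg G r ≡ 2)
      × (∀ v → v ∈ vertices G → indeg G v ≡ 0 → v ≡ r)
      × (∀ v → v ∈ vertices G → v ≢ r →
           IsLeafDeg G v ⊎ IsTreeVertex G v ⊎ IsReticulation G v)))

IsLeaf : Graph → ℕ → Set
IsLeaf G x = (x ∈ vertices G) × (outdeg G x ≡ 0)

IsCherry : Graph → ℕ → ℕ → ℕ → Set
IsCherry G a b p =
  (a ≢ b) × IsLeaf G a × IsLeaf G b × ((p , a) ∈ arcs G) × ((p , b) ∈ arcs G)

IsReticulatedCherry : Graph → ℕ → ℕ → ℕ → ℕ → Set
IsReticulatedCherry G a b pa pb =
  (a ≢ b) × IsLeaf G a × IsLeaf G b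
  × ((pa , a) ∈ arcs G) × ((pb , b) ∈ arcs G)
  × IsReticulation G pb × ((pa , pb) ∈ arcs G)

deleteVertex : Graph → ℕ → Graph
deleteVertex G x = mkGraph
  (filter (λ y → ¬? (y ≟ x)) (vertices G))
  (filter (λ e → ¬? (proj₁ e ≟ x)) (filter (λ e → ¬? (proj₂ e ≟ x)) (arcs G)))

deleteArc : Graph → Arc → Graph
deleteArc G e = mkGraph (vertices G) (filter (λ f → ¬? (f ≟ₐ e)) (arcs G))

suppress : Graph → ℕ → Graph
suppress G v with inArcs G v | outArcs G v
... | (p , _) ∷ [] | (_ , c) ∷ [] =
  mkGraph (vertices (deleteVertex G v)) (arcs (deleteVertex G v) ++ [ (p , c) ])
... | _ | _ = G

reduceCherry : Graph → ℕ → ℕ → ℕ → Graph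
reduceCherry G a b p with indeg G p ≟ 0
... | yes _ = mkGraph [ a ] []
... | no _  = suppress (deleteVertex G b) p

cutReticulatedCherry : Graph → ℕ → ℕ → Graph
cutReticulatedCherry G pa pb = suppress (suppress (deleteArc G (pa , pb)) pa) pb

data Orchard : Graph → Set where
  done    : ∀ G → SingleVertex G → Orchard G
  cherry  : ∀ G a b p → IsCherry G a b p → Orchard (reduceCherry G a b p) → Orchard G
  retCut  : ∀ G a b pa pb → IsReticulatedCherry G a b pa pb
            → Orchard (cutReticulatedCherry G pa pb) → Orchard G

IsStack : Graph → ℕ → ℕ → Set
IsStack G u v = IsReticulation G u × IsReticulation G v × ((u , v) ∈ arcs G)

StackFree : Graph → Set
StackFree G = ∀ u v → ¬ IsStack G u v

StackFreeOrchardNetwork : Graph → Set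
StackFreeOrchardNetwork G = IsNetwork G × StackFree G × Orchard G

-- Each reduction is a rewiring of the network: delete a few vertices (b and p for a
-- cherry; pa, and also pb when its in-degree drops to one, for a reticulated cherry)
-- and add the arcs bypassing them.  Every surviving vertex keeps its in- and
-- out-degree, except that a reticulation may lose an in-arc and stay a reticulation;
-- the added arcs end in leaves.  Hence the result is again a network, and a stack in
-- it would already be a stack of the original network.
--
-- Orchardness is preserved by a diamond argument, by induction on a reduction
-- sequence N, Q, ... ending in a single vertex.  Let P be any other reduction of N.
-- If P and Q touch disjoint parts of N they commute: Q(P(N)) is isomorphic to
-- P(Q(N)), which is orchard by induction, so P(N) is orchard.  Otherwise they share
-- the parent of a cherry, and P(N) and Q(N) are isomorphic (the two leaves swap
-- roles), or they share a reticulation leaf b; then one further reduction on each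
-- side (cutting the other reticulated cherry, or reducing b once its parent has been
-- suppressed) yields the same rewiring of N.

{-# OPTIONS --safe #-}
module Submission where

open import Defs
open import Data.Nat using (ℕ; zero; suc; _+_; _≤_; z≤n; s≤s; _≟_)
open import Data.Nat.Properties using (≤-trans; ≤-refl; n≤1+n; ≤-reflexive; +-suc; +-comm; <-irrefl; suc-injective)
open import Data.Product using (_×_; _,_; proj₁; proj₂; Σ; ∃)
open import Data.Sum using (_⊎_; inj₁; inj₂)
open import Data.Empty using (⊥; ⊥-elim)
open import Data.Unit using (⊤; tt)
open import Data.List using (List; []; _∷_; [_]; filter; length; _++_; map)
open import Data.List.Properties using (length-map; filter-notAll)
open import Data.List.Membership.Propositional using (_∈_; _∉_)
open import Data.List.Membership.Propositional.Properties using (∈-filter⁺; ∈-filter⁻; ∈-map⁺; ∈-map⁻; ∈-++⁺ˡ; ∈-++⁺ʳ; ∈-++⁻)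
open import Data.List.Membership.Propositional.Properties.WithK using (unique∧set⇒bag)
open import Data.List.Membership.DecPropositional _≟_ using (_∈?_)
open import Data.List.Relation.Binary.BagAndSetEquality using (∼bag⇒↭)
open import Data.List.Relation.Binary.Permutation.Propositional.Properties using (↭-length)
open import Data.List.Relation.Unary.Any as Any using (here; there)
open import Data.List.Relation.Unary.All as All using (All; []; _∷_)
open import Data.List.Relation.Unary.All.Properties using (¬Any⇒All¬) renaming (map⁺ to All-map⁺)
open import Data.List.Relation.Unary.AllPairs using ([]; _∷_)
open import Data.List.Relation.Unary.Unique.Propositional using (Unique)
open import Data.List.Relation.Unary.Unique.Propositional.Properties using (filter⁺; ++⁺)
open import Function.Bundles using (mk⇔)
open import Relation.Binary.PropositionalEquality using (_≡_; _≢_; refl; sym; trans; cong; cong₂; subst; subst₂; ≢-sym)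
open import Relation.Nullary using (¬_; yes; no; Dec; ¬?)

0≢1 : 0 ≢ 1
0≢1 ()

0≢2 : 0 ≢ 2
0≢2 ()

1≢2 : 1 ≢ 2
1≢2 ()

3≰2 : ¬ (3 ≤ 2)
3≰2 (s≤s (s≤s ()))

≡⊎≢ : (x y : ℕ) → x ≡ y ⊎ x ≢ y
≡⊎≢ x y with x ≟ y
... | yes e = inj₁ e
... | no n = inj₂ n

2≤⇒≡2⊎3≤ : ∀ {n} → 2 ≤ n → n ≡ 2 ⊎ 3 ≤ n
2≤⇒≡2⊎3≤ {suc zero} (s≤s ())
2≤⇒≡2⊎3≤ {suc (suc zero)} _ = inj₁ refl
2≤⇒≡2⊎3≤ {suc (suc (suc n))} _ = inj₂ (s≤s (s≤s (s≤s z≤n)))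

3≤⇒≡3⊎4≤ : ∀ {n} → 3 ≤ n → n ≡ 3 ⊎ 4 ≤ n
3≤⇒≡3⊎4≤ {suc zero} (s≤s ())
3≤⇒≡3⊎4≤ {suc (suc zero)} (s≤s (s≤s ()))
3≤⇒≡3⊎4≤ {suc (suc (suc zero))} _ = inj₁ refl
3≤⇒≡3⊎4≤ {suc (suc (suc (suc n)))} _ = inj₂ (s≤s (s≤s (s≤s (s≤s z≤n))))

unique-sameSet⇒length≡ : {A : Set} {xs ys : List A} → Unique xs → Unique ys →
  (∀ {z} → z ∈ xs → z ∈ ys) → (∀ {z} → z ∈ ys → z ∈ xs) → length xs ≡ length ys
unique-sameSet⇒length≡ ux uy f g = ↭-length (∼bag⇒↭ (unique∧set⇒bag ux uy (mk⇔ f g)))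

unique-∷ : {A : Set} {w : A} {ys : List A} → w ∉ ys → Unique ys → Unique (w ∷ ys)
unique-∷ w∉ uy = ¬Any⇒All¬ _ w∉ ∷ uy

unique-sameSet-∷⇒length≡suc : {A : Set} {w : A} {xs ys : List A} → Unique xs → Unique ys → w ∉ ys →
  (∀ {z} → z ∈ xs → z ∈ ys ⊎ z ≡ w) → (∀ {z} → z ∈ ys → z ∈ xs) → w ∈ xs →
  length xs ≡ suc (length ys)
unique-sameSet-∷⇒length≡suc {w = w} {xs} {ys} ux uy w∉ f g w∈ = unique-sameSet⇒length≡ ux (unique-∷ w∉ uy) f' g'
  where
  f' : ∀ {z} → z ∈ xs → z ∈ w ∷ ys
  f' m with f m
  ... | inj₁ x = there x
  ... | inj₂ refl = here refl
  g' : ∀ {z} → z ∈ w ∷ ys → z ∈ xs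
  g' (here refl) = w∈
  g' (there m) = g m

remove : ℕ → List ℕ → List ℕ
remove x = filter (λ y → ¬? (y ≟ x))

length-remove< : ∀ {x} ys → x ∈ ys → suc (length (remove x ys)) ≤ length ys
length-remove< {x} ys m = filter-notAll (λ y → ¬? (y ≟ x)) ys (Any.map (λ x≡y y≢x → y≢x (sym x≡y)) m)

unique-⊆⇒length≤ : ∀ {xs ys : List ℕ} → Unique xs → (∀ {z} → z ∈ xs → z ∈ ys) → length xs ≤ length ys
unique-⊆⇒length≤ {[]} _ _ = z≤n
unique-⊆⇒length≤ {x ∷ xs} {ys} (x∉ ∷ ux) sub =
  ≤-trans (s≤s (unique-⊆⇒length≤ ux sub')) (length-remove< ys (sub (here refl)))
  where
  sub' : ∀ {z} → z ∈ xs → z ∈ remove x ys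
  sub' m = ∈-filter⁺ _ (sub (there m)) (λ z≡x → All.lookup x∉ m (sym z≡x))

unique-map-injectiveOn : {A B : Set} (f : A → B) {l : List A} → Unique l →
  (∀ {a b} → a ∈ l → b ∈ l → f a ≡ f b → a ≡ b) → Unique (map f l)
unique-map-injectiveOn f {[]} _ _ = []
unique-map-injectiveOn f {x ∷ l} (x∉ ∷ ul) inj =
  All-map⁺ (All.tabulate (λ m e → All.lookup x∉ m (inj (here refl) (there m) e))) ∷
  unique-map-injectiveOn f ul (λ m m' e → inj (there m) (there m') e)

all∈⇒⊆ : {A : Set} {xs ys : List A} → All (_∈ ys) xs → ∀ {x} → x ∈ xs → x ∈ ys
all∈⇒⊆ = All.lookup

WellFormed : Graph → Set
WellFormed G = Unique (vertices G) × Unique (arcs G)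

parents : Graph → ℕ → List ℕ
parents G x = map proj₁ (inArcs G x)

children : Graph → ℕ → List ℕ
children G x = map proj₂ (outArcs G x)

indeg≡length-parents : ∀ G x → indeg G x ≡ length (parents G x)
indeg≡length-parents G x = sym (length-map proj₁ (inArcs G x))

outdeg≡length-children : ∀ G x → outdeg G x ≡ length (children G x)
outdeg≡length-children G x = sym (length-map proj₂ (outArcs G x))

∈-parents⁺ : ∀ {G x u} → (u , x) ∈ arcs G → u ∈ parents G x
∈-parents⁺ {G} {x} m = ∈-map⁺ proj₁ (∈-filter⁺ (λ e → proj₂ e ≟ x) m refl)

∈-parents⁻ : ∀ {G x u} → u ∈ parents G x → (u , x) ∈ arcs G
∈-parents⁻ {G} {x} m with ∈-map⁻ proj₁ m
... | (u' , x') , m' , refl with ∈-filter⁻ (λ e → proj₂ e ≟ x) {xs = arcs G} m'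
... | m'' , refl = m''

∈-children⁺ : ∀ {G x u} → (x , u) ∈ arcs G → u ∈ children G x
∈-children⁺ {G} {x} m = ∈-map⁺ proj₂ (∈-filter⁺ (λ e → proj₁ e ≟ x) m refl)

∈-children⁻ : ∀ {G x u} → u ∈ children G x → (x , u) ∈ arcs G
∈-children⁻ {G} {x} m with ∈-map⁻ proj₂ m
... | (u' , x') , m' , refl with ∈-filter⁻ (λ e → proj₁ e ≟ x) {xs = arcs G} m'
... | m'' , refl = m''

parents-unique : ∀ {G} x → Unique (arcs G) → Unique (parents G x)
parents-unique {G} x u = unique-map-injectiveOn proj₁ (filter⁺ (λ e → proj₂ e ≟ x) u) inj
  where
  inj : ∀ {a b} → a ∈ inArcs G x → b ∈ inArcs G x → proj₁ a ≡ proj₁ b → a ≡ b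
  inj {a1 , a2} {b1 , b2} ma mb refl with ∈-filter⁻ (λ e → proj₂ e ≟ x) {xs = arcs G} ma | ∈-filter⁻ (λ e → proj₂ e ≟ x) {xs = arcs G} mb
  ... | _ , refl | _ , refl = refl

children-unique : ∀ {G} x → Unique (arcs G) → Unique (children G x)
children-unique {G} x u = unique-map-injectiveOn proj₂ (filter⁺ (λ e → proj₁ e ≟ x) u) inj
  where
  inj : ∀ {a b} → a ∈ outArcs G x → b ∈ outArcs G x → proj₂ a ≡ proj₂ b → a ≡ b
  inj {a1 , a2} {b1 , b2} ma mb refl with ∈-filter⁻ (λ e → proj₁ e ≟ x) {xs = arcs G} ma | ∈-filter⁻ (λ e → proj₁ e ≟ x) {xs = arcs G} mb
  ... | _ , refl | _ , refl = refl

indeg≡length : ∀ {G x} {L : List ℕ} → Unique (arcs G) → Unique L →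
  (∀ {u} → (u , x) ∈ arcs G → u ∈ L) → (∀ {u} → u ∈ L → (u , x) ∈ arcs G) → indeg G x ≡ length L
indeg≡length {G} {x} uA uL f g = trans (indeg≡length-parents G x)
  (unique-sameSet⇒length≡ (parents-unique {G} x uA) uL (λ m → f (∈-parents⁻ {G} m)) (λ m → ∈-parents⁺ {G} (g m)))

outdeg≡length : ∀ {G x} {L : List ℕ} → Unique (arcs G) → Unique L →
  (∀ {u} → (x , u) ∈ arcs G → u ∈ L) → (∀ {u} → u ∈ L → (x , u) ∈ arcs G) → outdeg G x ≡ length L
outdeg≡length {G} {x} uA uL f g = trans (outdeg≡length-children G x)
  (unique-sameSet⇒length≡ (children-unique {G} x uA) uL (λ m → f (∈-children⁻ {G} m)) (λ m → ∈-children⁺ {G} (g m)))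

indeg-cong : ∀ {G H x y} → Unique (arcs G) → Unique (arcs H) →
  (∀ {u} → (u , x) ∈ arcs G → (u , y) ∈ arcs H) → (∀ {u} → (u , y) ∈ arcs H → (u , x) ∈ arcs G) → indeg G x ≡ indeg H y
indeg-cong {G} {H} {x} {y} uG uH f g =
  trans (indeg≡length {G} uG (parents-unique {H} y uH) (λ m → ∈-parents⁺ {H} (f m)) (λ m → g (∈-parents⁻ {H} m)))
        (sym (indeg≡length-parents H y))

indeg≡suc : ∀ {G H x y w} → Unique (arcs G) → Unique (arcs H) →
  (∀ {u} → (u , x) ∈ arcs G → (u , y) ∈ arcs H ⊎ u ≡ w) → (∀ {u} → (u , y) ∈ arcs H → (u , x) ∈ arcs G) →
  (w , x) ∈ arcs G → (w , y) ∉ arcs H → indeg G x ≡ suc (indeg H y)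
indeg≡suc {G} {H} {x} {y} {w} uG uH f g wG wH =
  trans (indeg≡length-parents G x)
    (trans (unique-sameSet-∷⇒length≡suc (parents-unique {G} x uG) (parents-unique {H} y uH) (λ m → wH (∈-parents⁻ {H} m)) f'
                                        (λ m → ∈-parents⁺ {G} (g (∈-parents⁻ {H} m))) (∈-parents⁺ {G} wG))
    (cong suc (sym (indeg≡length-parents H y))))
  where f' : ∀ {z} → z ∈ parents G x → z ∈ parents H y ⊎ z ≡ w
        f' m with f (∈-parents⁻ {G} m)
        ... | inj₁ k = inj₁ (∈-parents⁺ {H} k)
        ... | inj₂ e = inj₂ e

outdeg-cong-bij : ∀ {G H x} (φ ψ : ℕ → ℕ) → Unique (arcs G) → Unique (arcs H) →
  (∀ {u} → (x , u) ∈ arcs G → ((x , φ u) ∈ arcs H) × (ψ (φ u) ≡ u)) →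
  (∀ {v} → (x , v) ∈ arcs H → ((x , ψ v) ∈ arcs G) × (φ (ψ v) ≡ v)) → outdeg G x ≡ outdeg H x
outdeg-cong-bij {G} {H} {x} φ ψ uG uH f g =
  trans (outdeg≡length-children G x) (trans (sym (length-map φ (children G x)))
    (trans (unique-sameSet⇒length≡ (unique-map-injectiveOn φ (children-unique {G} x uG) inj) (children-unique {H} x uH) fw bw) (sym (outdeg≡length-children H x))))
  where
  inj : ∀ {a b} → a ∈ children G x → b ∈ children G x → φ a ≡ φ b → a ≡ b
  inj ma mb e = trans (sym (proj₂ (f (∈-children⁻ {G} ma)))) (trans (cong ψ e) (proj₂ (f (∈-children⁻ {G} mb))))
  fw : ∀ {z} → z ∈ map φ (children G x) → z ∈ children H x
  fw m with ∈-map⁻ φ m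
  ... | u , mu , refl = ∈-children⁺ {H} (proj₁ (f (∈-children⁻ {G} mu)))
  bw : ∀ {z} → z ∈ children H x → z ∈ map φ (children G x)
  bw {z} m = subst (_∈ map φ (children G x)) (proj₂ (g (∈-children⁻ {H} m))) (∈-map⁺ φ (∈-children⁺ {G} (proj₁ (g (∈-children⁻ {H} m)))))

indeg≡0⇒∉ : ∀ {G x u} → indeg G x ≡ 0 → (u , x) ∉ arcs G
indeg≡0⇒∉ {G} {x} e m with parents G x | indeg≡length-parents G x | ∈-parents⁺ {G} {x} m
... | [] | _ | ()
... | _ ∷ _ | e' | _ with trans (sym e) e'
... | ()

outdeg≡0⇒∉ : ∀ {G x u} → outdeg G x ≡ 0 → (x , u) ∉ arcs G
outdeg≡0⇒∉ {G} {x} e m with children G x | outdeg≡length-children G x | ∈-children⁺ {G} {x} m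
... | [] | _ | ()
... | _ ∷ _ | e' | _ with trans (sym e) e'
... | ()

∉⇒outdeg≡0 : ∀ {G x} → (∀ {u} → (x , u) ∉ arcs G) → outdeg G x ≡ 0
∉⇒outdeg≡0 {G} {x} n with children G x | outdeg≡length-children G x | ∈-children⁻ {G} {x}
... | [] | e | _ = e
... | u ∷ _ | _ | k = ⊥-elim (n (k (here refl)))

indeg≡1⇒parent≡ : ∀ {G x u v} → indeg G x ≡ 1 → (u , x) ∈ arcs G → (v , x) ∈ arcs G → u ≡ v
indeg≡1⇒parent≡ {G} {x} e mu mv with parents G x | indeg≡length-parents G x | ∈-parents⁺ {G} mu | ∈-parents⁺ {G} mv
... | _ ∷ [] | _ | here refl | here refl = refl
... | _ ∷ _ ∷ _ | e' | _ | _ with trans (sym e) e'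
... | ()

uniqueParent⇒indeg≡1 : ∀ {G x p} → Unique (arcs G) → (p , x) ∈ arcs G → (∀ {u} → (u , x) ∈ arcs G → u ≡ p) → indeg G x ≡ 1
uniqueParent⇒indeg≡1 {G} uG m f = indeg≡length {G} {L = _ ∷ []} uG ([] ∷ []) (λ m' → here (f m')) (λ { (here refl) → m })

outdeg≡1⇒child≡ : ∀ {G x u v} → outdeg G x ≡ 1 → (x , u) ∈ arcs G → (x , v) ∈ arcs G → u ≡ v
outdeg≡1⇒child≡ {G} {x} e mu mv with children G x | outdeg≡length-children G x | ∈-children⁺ {G} mu | ∈-children⁺ {G} mv
... | _ ∷ [] | _ | here refl | here refl = refl
... | _ ∷ _ ∷ _ | e' | _ | _ with trans (sym e) e'
... | ()

uniqueChild⇒outdeg≡1 : ∀ {G x p} → Unique (arcs G) → (x , p) ∈ arcs G → (∀ {u} → (x , u) ∈ arcs G → u ≡ p) → outdeg G x ≡ 1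
uniqueChild⇒outdeg≡1 {G} uG m f = outdeg≡length {G} {L = _ ∷ []} uG ([] ∷ []) (λ m' → here (f m')) (λ { (here refl) → m })

length≡2⇒members : ∀ {L : List ℕ} {c₁ c₂ u} → length L ≡ 2 → c₁ ∈ L → c₂ ∈ L → c₁ ≢ c₂ → u ∈ L → u ≡ c₁ ⊎ u ≡ c₂
length≡2⇒members {x ∷ y ∷ []} _ (here refl) (here refl) n _ = ⊥-elim (n refl)
length≡2⇒members {x ∷ y ∷ []} _ (there (here refl)) (there (here refl)) n _ = ⊥-elim (n refl)
length≡2⇒members {x ∷ y ∷ []} _ (here refl) (there (here refl)) n (here refl) = inj₁ refl
length≡2⇒members {x ∷ y ∷ []} _ (here refl) (there (here refl)) n (there (here refl)) = inj₂ refl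
length≡2⇒members {x ∷ y ∷ []} _ (there (here refl)) (here refl) n (here refl) = inj₂ refl
length≡2⇒members {x ∷ y ∷ []} _ (there (here refl)) (here refl) n (there (here refl)) = inj₁ refl

indeg≡2⇒parents : ∀ {G x u v w} → indeg G x ≡ 2 → (u , x) ∈ arcs G → (v , x) ∈ arcs G → u ≢ v → (w , x) ∈ arcs G → w ≡ u ⊎ w ≡ v
indeg≡2⇒parents {G} {x} i mu mv u≢v mw =
  length≡2⇒members (trans (sym (indeg≡length-parents G x)) i) (∈-parents⁺ {G} mu) (∈-parents⁺ {G} mv) u≢v (∈-parents⁺ {G} mw)

outdeg≡2⇒children : ∀ {G x u v w} → outdeg G x ≡ 2 → (x , u) ∈ arcs G → (x , v) ∈ arcs G → u ≢ v → (x , w) ∈ arcs G → w ≡ u ⊎ w ≡ v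
outdeg≡2⇒children {G} {x} o mu mv u≢v mw =
  length≡2⇒members (trans (sym (outdeg≡length-children G x)) o) (∈-children⁺ {G} mu) (∈-children⁺ {G} mv) u≢v (∈-children⁺ {G} mw)

∃-member≢ : {P : ℕ → Set} (w : ℕ) (L : List ℕ) → Unique L → 2 ≤ length L → (∀ {u} → u ∈ L → P u) →
  Σ ℕ λ u → (u ≢ w) × P u
∃-member≢ w [] _ () _
∃-member≢ w (_ ∷ []) _ (s≤s ()) _
∃-member≢ w (u ∷ v ∷ _) ((u≢v ∷ _) ∷ _) _ k with u ≟ w
... | no n = u , n , k (here refl)
... | yes refl = v , (λ e → u≢v (sym e)) , k (there (here refl))

indeg≥2⇒otherParent : ∀ {G x} w → Unique (arcs G) → 2 ≤ indeg G x → Σ ℕ λ u → (u ≢ w) × ((u , x) ∈ arcs G)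
indeg≥2⇒otherParent {G} {x} w uG le = ∃-member≢ w (parents G x) (parents-unique {G} x uG) (subst (2 ≤_) (indeg≡length-parents G x) le) (∈-parents⁻ {G})

indeg≢0⇒parent : ∀ {G x} → indeg G x ≢ 0 → Σ ℕ λ u → (u , x) ∈ arcs G
indeg≢0⇒parent {G} {x} n with parents G x | indeg≡length-parents G x | ∈-parents⁻ {G} {x}
... | [] | e | _ = ⊥-elim (n e)
... | u ∷ _ | _ | k = u , k (here refl)

Path⁺-++ : ∀ {G x y z} → Path⁺ G x y → Path⁺ G y z → Path⁺ G x z
Path⁺-++ (edge m) q = step m q
Path⁺-++ (step m p) q = step m (Path⁺-++ p q)

Path⁺-simulate : ∀ {G H} → (∀ {u v} → (u , v) ∈ arcs H → Path⁺ G u v) → ∀ {x y} → Path⁺ H x y → Path⁺ G x y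
Path⁺-simulate k (edge m) = k m
Path⁺-simulate k (step m p) = Path⁺-++ (k m) (Path⁺-simulate k p)

outdeg≡0⇒noPath : ∀ {G x y} → outdeg G x ≡ 0 → Path⁺ G x y → ⊥
outdeg≡0⇒noPath {G} o (edge m) = outdeg≡0⇒∉ {G} o m
outdeg≡0⇒noPath {G} o (step m _) = outdeg≡0⇒∉ {G} o m

module Cherry {G : Graph} {a b p : ℕ} (c : IsCherry G a b p) where
  a≢b : a ≢ b
  a≢b = proj₁ c
  la : IsLeaf G a
  la = let (_ , l , _) = c in l
  lb : IsLeaf G b
  lb = let (_ , _ , l , _) = c in l
  ma : (p , a) ∈ arcs G
  ma = let (_ , _ , _ , m , _) = c in m
  mb : (p , b) ∈ arcs G
  mb = let (_ , _ , _ , _ , m) = c in m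
  am : a ∈ vertices G
  am = proj₁ la
  ao : outdeg G a ≡ 0
  ao = proj₂ la
  bm : b ∈ vertices G
  bm = proj₁ lb
  bo : outdeg G b ≡ 0
  bo = proj₂ lb

module RetCherry {G : Graph} {a b pa pb : ℕ} (c : IsReticulatedCherry G a b pa pb) where
  a≢b : a ≢ b
  a≢b = proj₁ c
  la : IsLeaf G a
  la = let (_ , l , _) = c in l
  lb : IsLeaf G b
  lb = let (_ , _ , l , _) = c in l
  ma : (pa , a) ∈ arcs G
  ma = let (_ , _ , _ , m , _) = c in m
  mb : (pb , b) ∈ arcs G
  mb = let (_ , _ , _ , _ , m , _) = c in m
  rb : IsReticulation G pb
  rb = let (_ , _ , _ , _ , _ , r , _) = c in r
  mab : (pa , pb) ∈ arcs G
  mab = let (_ , _ , _ , _ , _ , _ , m) = c in m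
  am : a ∈ vertices G
  am = proj₁ la
  ao : outdeg G a ≡ 0
  ao = proj₂ la
  bm : b ∈ vertices G
  bm = proj₁ lb
  bo : outdeg G b ≡ 0
  bo = proj₂ lb
  ri : 2 ≤ indeg G pb
  ri = proj₁ rb
  ro : outdeg G pb ≡ 1
  ro = proj₂ rb

-- The second alternative of IsNetwork, with named fields.
record ProperNetwork (N : Graph) : Set where
  constructor proper
  field
    uniqueV : Unique (vertices N)
    uniqueA : Unique (arcs N)
    arcEnds : ∀ u v → (u , v) ∈ arcs N → (u ∈ vertices N) × (v ∈ vertices N)
    acyclic : Acyclic N
    root : ℕ
    root∈ : root ∈ vertices N
    root-indeg : indeg N root ≡ 0
    root-outdeg : outdeg N root ≡ 2
    root-unique : ∀ v → v ∈ vertices N → indeg N v ≡ 0 → v ≡ root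
    classify : ∀ v → v ∈ vertices N → v ≢ root → IsLeafDeg N v ⊎ IsTreeVertex N v ⊎ IsReticulation N v

properNetwork : ∀ {N} → IsNetwork N → ∀ {e} → e ∈ arcs N → ProperNetwork N
properNetwork (inj₁ (x , _ , eA)) m rewrite eA with m
... | ()
properNetwork (inj₂ (uV , uA , ends , acyc , r , r∈ , r-in , r-out , r-unique , cls)) _ = proper uV uA ends acyc r r∈ r-in r-out r-unique cls

cherry⇒properNetwork : ∀ {N a b p} → IsNetwork N → IsCherry N a b p → ProperNetwork N
cherry⇒properNetwork net c = properNetwork net (Cherry.ma c)

retCherry⇒properNetwork : ∀ {N a b pa pb} → IsNetwork N → IsReticulatedCherry N a b pa pb → ProperNetwork N
retCherry⇒properNetwork net c = properNetwork net (RetCherry.ma c)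

network⇒wellFormed : ∀ {N} → IsNetwork N → WellFormed N
network⇒wellFormed (inj₁ (x , eV , eA)) rewrite eV | eA = ([] ∷ []) , []
network⇒wellFormed (inj₂ (uniqueV , uniqueA , _)) = uniqueV , uniqueA

module NetworkFacts {N : Graph} (nt : ProperNetwork N) where
  open ProperNetwork nt

  noLoop : ∀ {u} → (u , u) ∉ arcs N
  noLoop {u} m = acyclic u (edge m)

  tailV : ∀ {u v} → (u , v) ∈ arcs N → u ∈ vertices N
  tailV m = proj₁ (arcEnds _ _ m)

  headV : ∀ {u v} → (u , v) ∈ arcs N → v ∈ vertices N
  headV m = proj₂ (arcEnds _ _ m)

  head≢root : ∀ {u v} → (u , v) ∈ arcs N → v ≢ root
  head≢root m refl = indeg≡0⇒∉ {N} root-indeg m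

  leaf-indeg≡1 : ∀ {x} → IsLeaf N x → indeg N x ≡ 1
  leaf-indeg≡1 {x} (m , o) with x ≟ root
  ... | yes refl = ⊥-elim (0≢2 (trans (sym o) root-outdeg))
  ... | no n with classify x m n
  ...   | inj₁ (_ , i) = i
  ...   | inj₂ (inj₁ (_ , o')) = ⊥-elim (0≢2 (trans (sym o) o'))
  ...   | inj₂ (inj₂ (_ , o')) = ⊥-elim (0≢1 (trans (sym o) o'))

  leaf-uniqueParent : ∀ {x p u} → IsLeaf N x → (p , x) ∈ arcs N → (u , x) ∈ arcs N → u ≡ p
  leaf-uniqueParent l mp mu = indeg≡1⇒parent≡ {N} (leaf-indeg≡1 l) mu mp

  leaf≢tail : ∀ {x u v} → outdeg N x ≡ 0 → (u , v) ∈ arcs N → x ≢ u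
  leaf≢tail o m refl = outdeg≡0⇒∉ {N} o m

  twoChildren⇒outdeg≡2 : ∀ {p a b} → (p , a) ∈ arcs N → (p , b) ∈ arcs N → a ≢ b → outdeg N p ≡ 2
  twoChildren⇒outdeg≡2 {p} ma mb n with p ≟ root
  ... | yes refl = root-outdeg
  ... | no n' with classify p (tailV ma) n'
  ...   | inj₁ (o , _) = ⊥-elim (outdeg≡0⇒∉ {N} o ma)
  ...   | inj₂ (inj₁ (_ , o)) = o
  ...   | inj₂ (inj₂ (_ , o)) = ⊥-elim (n (outdeg≡1⇒child≡ {N} o ma mb))

  outdeg≡2⇒indeg≡1 : ∀ {p q} → outdeg N p ≡ 2 → (q , p) ∈ arcs N → indeg N p ≡ 1
  outdeg≡2⇒indeg≡1 {p} o m with classify p (headV m) (head≢root m)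
  ... | inj₁ (o' , _) = ⊥-elim (0≢2 (trans (sym o') o))
  ... | inj₂ (inj₁ (i , _)) = i
  ... | inj₂ (inj₂ (_ , o')) = ⊥-elim (1≢2 (trans (sym o') o))

  reticulation≢root : ∀ {x} → IsReticulation N x → x ≢ root
  reticulation≢root (i , _) refl with subst (2 ≤_) root-indeg i
  ... | ()

  -- Walk backwards from v along parent arcs, keeping the duplicate-free list S of
  -- visited vertices, each reachable from the current one.  S cannot outgrow the
  -- vertex set, so within |V| steps the walk reaches an in-degree-0 vertex: the root.
  reachableFromRoot : ∀ v → v ∈ vertices N → v ≡ root ⊎ Path⁺ N root v
  reachableFromRoot v vm = go (suc (length (vertices N))) v vm (v ∷ []) ([] ∷ []) (λ { (here refl) → vm }) (λ { (here refl) → inj₁ refl }) (inj₁ refl)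
      (≤-trans (n≤1+n _) ≤-refl)
    where
    go : (k : ℕ) (w : ℕ) → w ∈ vertices N → (S : List ℕ) → Unique S → (∀ {z} → z ∈ S → z ∈ vertices N) →
      (∀ {s} → s ∈ S → w ≡ s ⊎ Path⁺ N w s) → (w ≡ v ⊎ Path⁺ N w v) → suc (length (vertices N)) ≤ length S + k →
      v ≡ root ⊎ Path⁺ N root v
    go zero w wm S uS sub cl rv le = ⊥-elim (<-irrefl refl (≤-trans (subst (suc (length (vertices N)) ≤_) (+-comm (length S) 0) le) (unique-⊆⇒length≤ uS sub)))
    go (suc k) w wm S uS sub cl rv le with indeg N w ≟ 0
    ... | yes e with root-unique w wm e
    ...   | refl with rv
    ...     | inj₁ refl = inj₁ refl
    ...     | inj₂ p = inj₂ p
    go (suc k) w wm S uS sub cl rv le | no ne with parents N w | indeg≡length-parents N w | ∈-parents⁻ {N} {w}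
    ...   | [] | e | _ = ⊥-elim (ne e)
    ...   | x ∷ _ | _ | pk with pk (here refl)
    ...     | xw with x ∈? S
    ...       | yes xs with cl xs
    ...         | inj₁ refl = ⊥-elim (noLoop xw)
    ...         | inj₂ p = ⊥-elim (acyclic x (step xw p))
    go (suc k) w wm S uS sub cl rv le | no ne | x ∷ _ | _ | pk | xw | no xs =
      go k x (tailV xw) (x ∷ S) (unique-∷ xs uS) sub' cl' rv' (subst (suc (length (vertices N)) ≤_) (+-suc (length S) k) le)
      where
      sub' : ∀ {z} → z ∈ x ∷ S → z ∈ vertices N
      sub' (here refl) = tailV xw
      sub' (there m) = sub m
      cl' : ∀ {s} → s ∈ x ∷ S → x ≡ s ⊎ Path⁺ N x s
      cl' (here refl) = inj₁ refl
      cl' (there m) with cl m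
      ... | inj₁ refl = inj₂ (edge xw)
      ... | inj₂ p = inj₂ (step xw p)
      rv' : x ≡ v ⊎ Path⁺ N x v
      rv' = ext rv
        where ext : w ≡ v ⊎ Path⁺ N w v → x ≡ v ⊎ Path⁺ N x v
              ext (inj₁ refl) = inj₂ (edge xw)
              ext (inj₂ p) = inj₂ (step xw p)

  -- If pa were the root, the other parent of pb would be reachable from pa; but every
  -- path leaving pa runs into the leaves a and b.
  treeParent-hasParent : ∀ {a b pa pb} → IsReticulatedCherry N a b pa pb → Σ ℕ λ ga → (ga , pa) ∈ arcs N
  treeParent-hasParent {a} {b} {pa} {pb} (a≢b , (am , ao) , (bm , bo) , mpa , mpb , (ri , ro) , mab) with parents N pa | indeg≡length-parents N pa | ∈-parents⁻ {N} {pa}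
  ... | x ∷ _ | _ | k = x , k (here refl)
  ... | [] | e | _ with root-unique pa (tailV mpa) e
  ...   | refl with indeg≥2⇒otherParent {N} {pb} pa uniqueA ri
  ...     | q , q≢ , mq with reachableFromRoot q (tailV mq)
  ...       | inj₁ refl = ⊥-elim (q≢ refl)
  ...       | inj₂ p = ⊥-elim (bad p)
    where
    a≢pb : a ≢ pb
    a≢pb refl = 0≢1 (trans (sym ao) ro)
    tw : ∀ {w} → (pa , w) ∈ arcs N → w ≡ a ⊎ w ≡ pb
    tw = outdeg≡2⇒children {N} (twoChildren⇒outdeg≡2 mpa mab a≢pb) mpa mab a≢pb
    pbpath : ∀ {y} → Path⁺ N pb y → y ≡ b
    pbpath (edge m) = outdeg≡1⇒child≡ {N} ro m mpb
    pbpath (step m p) with outdeg≡1⇒child≡ {N} ro m mpb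
    ... | refl = ⊥-elim (outdeg≡0⇒noPath bo p)
    bad : Path⁺ N pa q → ⊥
    bad (edge m) with tw m
    ... | inj₁ refl = outdeg≡0⇒∉ {N} ao mq
    ... | inj₂ refl = noLoop mq
    bad (step m p) with tw m
    ... | inj₁ refl = outdeg≡0⇒noPath ao p
    ... | inj₂ refl with pbpath p
    ...   | refl = outdeg≡0⇒∉ {N} bo mq

record Relabelling : Set where
  constructor relabelling
  field
    f g : ℕ → ℕ
    gf : ∀ x → g (f x) ≡ x
    fg : ∀ x → f (g x) ≡ x

idᴿ : Relabelling
idᴿ = relabelling (λ x → x) (λ x → x) (λ _ → refl) (λ _ → refl)

symᴿ : Relabelling → Relabelling
symᴿ (relabelling f g gf fg) = relabelling g f fg gf

_∘ᴿ_ : Relabelling → Relabelling → Relabelling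
relabelling f g gf fg ∘ᴿ relabelling f' g' gf' fg' =
  relabelling (λ x → f' (f x)) (λ x → g (g' x)) (λ x → trans (cong g (gf' (f x))) (gf x)) (λ x → trans (cong f' (fg (g' x))) (fg' x))

record _≈[_]_ (G : Graph) (β : Relabelling) (H : Graph) : Set where
  constructor iso
  open Relabelling β
  field
    v→ : ∀ {x} → x ∈ vertices G → f x ∈ vertices H
    v← : ∀ {y} → y ∈ vertices H → g y ∈ vertices G
    a→ : ∀ {u v} → (u , v) ∈ arcs G → (f u , f v) ∈ arcs H
    a← : ∀ {u v} → (u , v) ∈ arcs H → (g u , g v) ∈ arcs G

≈-sym : ∀ {G H β} → G ≈[ β ] H → H ≈[ symᴿ β ] G
≈-sym (iso v→ v← a→ a←) = iso v← v→ a← a→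

≈-trans : ∀ {G H K β γ} → G ≈[ β ] H → H ≈[ γ ] K → G ≈[ β ∘ᴿ γ ] K
≈-trans (iso v→ v← a→ a←) (iso v→' v←' a→' a←') = iso (λ m → v→' (v→ m)) (λ m → v← (v←' m)) (λ m → a→' (a→ m)) (λ m → a← (a←' m))

≈-refl : ∀ {G} → G ≈[ idᴿ ] G
≈-refl = iso (λ m → m) (λ m → m) (λ m → m) (λ m → m)

≈-subst : ∀ {G G' H β} → G ≡ G' → G' ≈[ β ] H → G ≈[ β ] H
≈-subst refl e = e

replace : ℕ → ℕ → ℕ → ℕ
replace s t u with u ≟ s
... | yes _ = t
... | no _ = u

replace-≡ : ∀ s t → replace s t s ≡ t
replace-≡ s t with s ≟ s
... | yes _ = refl
... | no n = ⊥-elim (n refl)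

replace-≢ : ∀ {s t u} → u ≢ s → replace s t u ≡ u
replace-≢ {s} {t} {u} n with u ≟ s
... | yes e = ⊥-elim (n e)
... | no _ = refl

swap : ℕ → ℕ → ℕ → ℕ
swap a b x with x ≟ a
... | yes _ = b
... | no _ with x ≟ b
...   | yes _ = a
...   | no _ = x

swap-ˡ : ∀ a b → swap a b a ≡ b
swap-ˡ a b with a ≟ a
... | yes _ = refl
... | no n = ⊥-elim (n refl)

swap-ʳ : ∀ a b → a ≢ b → swap a b b ≡ a
swap-ʳ a b n with b ≟ a
... | yes e = ⊥-elim (n (sym e))
... | no _ with b ≟ b
...   | yes _ = refl
...   | no n' = ⊥-elim (n' refl)

swap-≢ : ∀ {a b x} → x ≢ a → x ≢ b → swap a b x ≡ x
swap-≢ {a} {b} {x} n n' with x ≟ a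
... | yes e = ⊥-elim (n e)
... | no _ with x ≟ b
...   | yes e = ⊥-elim (n' e)
...   | no _ = refl

swap-involutive : ∀ a b x → a ≢ b → swap a b (swap a b x) ≡ x
swap-involutive a b x n with ≡⊎≢ x a | ≡⊎≢ x b
... | inj₁ refl | _ = trans (cong (swap x b) (swap-ˡ x b)) (swap-ʳ x b n)
... | inj₂ _ | inj₁ refl = trans (cong (swap a x) (swap-ʳ a x n)) (swap-ˡ a x)
... | inj₂ xa | inj₂ xb = trans (cong (swap a b) (swap-≢ xa xb)) (swap-≢ xa xb)

swapRelabelling : (a b : ℕ) → a ≢ b → Relabelling
swapRelabelling a b n = relabelling (swap a b) (swap a b) (λ x → swap-involutive a b x n) (λ x → swap-involutive a b x n)

module Transport {G H : Graph} {β : Relabelling} (eq : G ≈[ β ] H) (uG : Unique (arcs G)) (uH : Unique (arcs H)) where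
  open Relabelling β
  open _≈[_]_ eq

  arcInto← : ∀ {u x} → (u , f x) ∈ arcs H → (g u , x) ∈ arcs G
  arcInto← {u} {x} m = subst (λ z → (g u , z) ∈ arcs G) (gf x) (a← m)

  arcOutOf← : ∀ {u x} → (f x , u) ∈ arcs H → (x , g u) ∈ arcs G
  arcOutOf← {u} {x} m = subst (λ z → (z , g u) ∈ arcs G) (gf x) (a← m)

  f-injective : ∀ {a b} → f a ≡ f b → a ≡ b
  f-injective {a} {b} e = trans (sym (gf a)) (trans (cong g e) (gf b))

  indeg≈ : ∀ x → indeg H (f x) ≡ indeg G x
  indeg≈ x = trans (indeg≡length {H} {f x} {map f (parents G x)} uH (unique-map-injectiveOn f (parents-unique {G} x uG) (λ _ _ → f-injective))
     (λ {u} m → subst (_∈ map f (parents G x)) (fg u) (∈-map⁺ f (∈-parents⁺ {G} (arcInto← m))))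
     λ m → k (∈-map⁻ f m))
     (trans (length-map f (parents G x)) (sym (indeg≡length-parents G x)))
    where k : ∀ {u} → (∃ λ w → w ∈ parents G x × u ≡ f w) → (u , f x) ∈ arcs H
          k (w , m , refl) = a→ (∈-parents⁻ {G} m)

  outdeg≈ : ∀ x → outdeg H (f x) ≡ outdeg G x
  outdeg≈ x = trans (outdeg≡length {H} {f x} {map f (children G x)} uH (unique-map-injectiveOn f (children-unique {G} x uG) (λ _ _ → f-injective))
     (λ {u} m → subst (_∈ map f (children G x)) (fg u) (∈-map⁺ f (∈-children⁺ {G} (arcOutOf← m))))
     λ m → k (∈-map⁻ f m))
     (trans (length-map f (children G x)) (sym (outdeg≡length-children G x)))
    where k : ∀ {u} → (∃ λ w → w ∈ children G x × u ≡ f w) → (f x , u) ∈ arcs H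
          k (w , m , refl) = a→ (∈-children⁻ {G} m)

  path≈ : ∀ {x y} → Path⁺ G x y → Path⁺ H (f x) (f y)
  path≈ (edge m) = edge (a→ m)
  path≈ (step m p) = step (a→ m) (path≈ p)

  reticulation≈ : ∀ {x} → IsReticulation G x → IsReticulation H (f x)
  reticulation≈ {x} (i , o) = subst (2 ≤_) (sym (indeg≈ x)) i , trans (outdeg≈ x) o

  leaf≈ : ∀ {x} → IsLeaf G x → IsLeaf H (f x)
  leaf≈ {x} (m , o) = v→ m , trans (outdeg≈ x) o

  f-≢ : ∀ {a b} → a ≢ b → f a ≢ f b
  f-≢ n e = n (f-injective e)

  cherry≈ : ∀ {a b p} → IsCherry G a b p → IsCherry H (f a) (f b) (f p)
  cherry≈ (n , la , lb , ma , mb) = f-≢ n , leaf≈ la , leaf≈ lb , a→ ma , a→ mb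

  reticulatedCherry≈ : ∀ {a b pa pb} → IsReticulatedCherry G a b pa pb → IsReticulatedCherry H (f a) (f b) (f pa) (f pb)
  reticulatedCherry≈ (n , la , lb , ma , mb , rb , mab) = f-≢ n , leaf≈ la , leaf≈ lb , a→ ma , a→ mb , reticulation≈ rb , a→ mab

unique-constant⇒singleton : ∀ {ys : List ℕ} {z} → Unique ys → (∀ {y} → y ∈ ys → y ≡ z) → z ∈ ys → ys ≡ z ∷ []
unique-constant⇒singleton {[]} _ _ ()
unique-constant⇒singleton {y ∷ []} _ k m with k (here refl)
... | refl = refl
unique-constant⇒singleton {y ∷ y' ∷ ys} ((n ∷ _) ∷ _) k m = ⊥-elim (n (trans (k (here refl)) (sym (k (there (here refl))))))

noMember⇒[] : ∀ {ys : List Arc} → (∀ {y} → y ∈ ys → ⊥) → ys ≡ []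
noMember⇒[] {[]} _ = refl
noMember⇒[] {y ∷ ys} k = ⊥-elim (k (here refl))

module _ {G H : Graph} {β : Relabelling} (eq : G ≈[ β ] H) where
  open Relabelling β
  open _≈[_]_ eq

  singleVertex≈ : SingleVertex G → WellFormed H → SingleVertex H
  singleVertex≈ (x , eV , eA) (uVH , uAH) = f x , unique-constant⇒singleton uVH k (v→ (subst (x ∈_) (sym eV) (here refl))) ,
     noMember⇒[] (λ m → noarc (a← m))
    where
    k : ∀ {y} → y ∈ vertices H → y ≡ f x
    k {y} m with subst (g y ∈_) eV (v← m)
    ... | here e = trans (sym (fg y)) (cong f e)
    noarc : ∀ {u v} → (u , v) ∈ arcs G → ⊥
    noarc m with subst ((_ , _) ∈_) eA m
    ... | ()

  network≈ : IsNetwork G → WellFormed H → IsNetwork H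
  network≈ (inj₁ s) gH = inj₁ (singleVertex≈ s gH)
  network≈ (inj₂ (uniqueV , uniqueA , arcEnds , acyclic , root , root∈ , root-indeg , root-outdeg , root-unique , classify)) (uVH , uAH) =
    inj₂ (uVH , uAH , ends' , acyc' , f root , v→ root∈ , trans (T.indeg≈ root) root-indeg , trans (T.outdeg≈ root) root-outdeg , rootU' , cls')
    where
    module T = Transport eq uniqueA uAH
    module S = Transport (≈-sym eq) uAH uniqueA
    ends' : ∀ u v → (u , v) ∈ arcs H → (u ∈ vertices H) × (v ∈ vertices H)
    ends' u v m with arcEnds _ _ (a← m)
    ... | mu , mv = subst (_∈ vertices H) (fg u) (v→ mu) , subst (_∈ vertices H) (fg v) (v→ mv)
    acyc' : Acyclic H
    acyc' v p = acyclic (g v) (S.path≈ p)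
    rootU' : ∀ v → v ∈ vertices H → indeg H v ≡ 0 → v ≡ f root
    rootU' v m e = trans (sym (fg v)) (cong f (root-unique (g v) (v← m) (trans (S.indeg≈ v) e)))
    cls' : ∀ v → v ∈ vertices H → v ≢ f root → IsLeafDeg H v ⊎ IsTreeVertex H v ⊎ IsReticulation H v
    cls' v m n with classify (g v) (v← m) (λ e → n (trans (sym (fg v)) (cong f e)))
    ... | inj₁ (o , i) = inj₁ (trans (sym (S.outdeg≈ v)) o , trans (sym (S.indeg≈ v)) i)
    ... | inj₂ (inj₁ (i , o)) = inj₂ (inj₁ (trans (sym (S.indeg≈ v)) i , trans (sym (S.outdeg≈ v)) o))
    ... | inj₂ (inj₂ (i , o)) = inj₂ (inj₂ (subst (2 ≤_) (S.indeg≈ v) i , trans (sym (S.outdeg≈ v)) o))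

  stackfree≈ : Unique (arcs G) → Unique (arcs H) → StackFree G → StackFree H
  stackfree≈ uG uH sf u v (ru , rv , m) = sf (g u) (g v) (S.reticulation≈ ru , S.reticulation≈ rv , a← m)
    where module S = Transport (≈-sym eq) uH uG

-- Rewiring

keepVertex? : (R : List ℕ) → (x : ℕ) → Dec (¬ (x ∈ R))
keepVertex? R x = ¬? (x ∈? R)

keepArc? : (R : List ℕ) → (e : Arc) → Dec (¬ (proj₁ e ∈ R) × ¬ (proj₂ e ∈ R))
keepArc? R (u , v) with u ∈? R | v ∈? R
... | yes m | _ = no (λ k → proj₁ k m)
... | no m | yes m' = no (λ k → proj₂ k m')
... | no m | no m' = yes (m , m')

rewire : Graph → List ℕ → List Arc → Graph
rewire G R New = mkGraph (filter (keepVertex? R) (vertices G)) (filter (keepArc? R) (arcs G) ++ New)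

rewireV⁺ : ∀ {G R New x} → x ∈ vertices G → x ∉ R → x ∈ vertices (rewire G R New)
rewireV⁺ {G} {R} m n = ∈-filter⁺ (keepVertex? R) m n

rewireV⁻ : ∀ {G R New x} → x ∈ vertices (rewire G R New) → (x ∈ vertices G) × (x ∉ R)
rewireV⁻ {G} {R} m = ∈-filter⁻ (keepVertex? R) {xs = vertices G} m

rewireA⁺ : ∀ {G R New u v} → (u , v) ∈ arcs G → u ∉ R → v ∉ R → (u , v) ∈ arcs (rewire G R New)
rewireA⁺ {G} {R} m n n' = ∈-++⁺ˡ (∈-filter⁺ (keepArc? R) m (n , n'))

rewireNew⁺ : ∀ {G R New e} → e ∈ New → e ∈ arcs (rewire G R New)
rewireNew⁺ {G} {R} m = ∈-++⁺ʳ (filter (keepArc? R) (arcs G)) m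

rewireA⁻ : ∀ {G R New u v} → (u , v) ∈ arcs (rewire G R New) → (((u , v) ∈ arcs G) × (u ∉ R) × (v ∉ R)) ⊎ ((u , v) ∈ New)
rewireA⁻ {G} {R} m with ∈-++⁻ (filter (keepArc? R) (arcs G)) m
... | inj₂ k = inj₂ k
... | inj₁ k with ∈-filter⁻ (keepArc? R) {xs = arcs G} k
... | k' , n , n' = inj₁ (k' , n , n')

rewire-cong : ∀ {G H β R R' New New'} → G ≈[ β ] H →
  (∀ {x} → x ∈ R → Relabelling.f β x ∈ R') → (∀ {y} → y ∈ R' → Relabelling.g β y ∈ R) →
  (∀ {u v} → (u , v) ∈ New → (Relabelling.f β u , Relabelling.f β v) ∈ New') →
  (∀ {u v} → (u , v) ∈ New' → (Relabelling.g β u , Relabelling.g β v) ∈ New) →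
  rewire G R New ≈[ β ] rewire H R' New'
rewire-cong {G} {H} {β} {R} {R'} {New} {New'} (iso v→ v← a→ a←) r→ r← n→ n← = iso v→' v←' a→' a←'
  where
  open Relabelling β
  nf : ∀ {x} → x ∉ R → f x ∉ R'
  nf {x} n m = n (subst (_∈ R) (gf x) (r← m))
  ng : ∀ {y} → y ∉ R' → g y ∉ R
  ng {y} n m = n (subst (_∈ R') (fg y) (r→ m))
  v→' : ∀ {x} → x ∈ vertices (rewire G R New) → f x ∈ vertices (rewire H R' New')
  v→' m with rewireV⁻ {G} {R} {New} m
  ... | m' , n = rewireV⁺ {H} {R'} {New'} (v→ m') (nf n)
  v←' : ∀ {y} → y ∈ vertices (rewire H R' New') → g y ∈ vertices (rewire G R New)
  v←' m with rewireV⁻ {H} {R'} {New'} m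
  ... | m' , n = rewireV⁺ {G} {R} {New} (v← m') (ng n)
  a→' : ∀ {u v} → (u , v) ∈ arcs (rewire G R New) → (f u , f v) ∈ arcs (rewire H R' New')
  a→' m with rewireA⁻ {G} m
  ... | inj₁ (m' , n , n') = rewireA⁺ {H} (a→ m') (nf n) (nf n')
  ... | inj₂ k = rewireNew⁺ {H} {R'} (n→ k)
  a←' : ∀ {u v} → (u , v) ∈ arcs (rewire H R' New') → (g u , g v) ∈ arcs (rewire G R New)
  a←' m with rewireA⁻ {H} m
  ... | inj₁ (m' , n , n') = rewireA⁺ {G} (a← m') (ng n) (ng n')
  ... | inj₂ k = rewireNew⁺ {G} {R} (n← k)

surviving : List ℕ → List Arc → List Arc
surviving R = filter (keepArc? R)

rewire-∘ : ∀ G R1 N1 R2 N2 → rewire (rewire G R1 N1) R2 N2 ≈[ idᴿ ] rewire G (R1 ++ R2) (surviving R2 N1 ++ N2)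
rewire-∘ G R1 N1 R2 N2 = iso v→ v← a→ a←
  where
  notboth : ∀ {x} → x ∉ R1 → x ∉ R2 → x ∉ R1 ++ R2
  notboth n n' m with ∈-++⁻ R1 m
  ... | inj₁ k = n k
  ... | inj₂ k = n' k
  not1 : ∀ {x} → x ∉ R1 ++ R2 → x ∉ R1
  not1 n m = n (∈-++⁺ˡ m)
  not2 : ∀ {x} → x ∉ R1 ++ R2 → x ∉ R2
  not2 n m = n (∈-++⁺ʳ R1 m)
  v→ : ∀ {x} → x ∈ vertices (rewire (rewire G R1 N1) R2 N2) → x ∈ vertices (rewire G (R1 ++ R2) (surviving R2 N1 ++ N2))
  v→ m with rewireV⁻ {rewire G R1 N1} {R2} {N2} m
  ... | m' , n with rewireV⁻ {G} {R1} {N1} m'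
  ... | m'' , n' = rewireV⁺ {G} {R1 ++ R2} {surviving R2 N1 ++ N2} m'' (notboth n' n)
  v← : ∀ {x} → x ∈ vertices (rewire G (R1 ++ R2) (surviving R2 N1 ++ N2)) → x ∈ vertices (rewire (rewire G R1 N1) R2 N2)
  v← m with rewireV⁻ {G} {R1 ++ R2} {surviving R2 N1 ++ N2} m
  ... | m' , n = rewireV⁺ {rewire G R1 N1} {R2} {N2} (rewireV⁺ {G} {R1} {N1} m' (not1 n)) (not2 n)
  a→ : ∀ {u v} → (u , v) ∈ arcs (rewire (rewire G R1 N1) R2 N2) → (u , v) ∈ arcs (rewire G (R1 ++ R2) (surviving R2 N1 ++ N2))
  a→ m with rewireA⁻ {rewire G R1 N1} m
  ... | inj₂ k = rewireNew⁺ {G} {R1 ++ R2} (∈-++⁺ʳ (surviving R2 N1) k)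
  ... | inj₁ (m' , n , n') with rewireA⁻ {G} m'
  ...   | inj₁ (m'' , k , k') = rewireA⁺ {G} m'' (notboth k n) (notboth k' n')
  ...   | inj₂ k = rewireNew⁺ {G} {R1 ++ R2} (∈-++⁺ˡ (∈-filter⁺ (keepArc? R2) k (n , n')))
  a← : ∀ {u v} → (u , v) ∈ arcs (rewire G (R1 ++ R2) (surviving R2 N1 ++ N2)) → (u , v) ∈ arcs (rewire (rewire G R1 N1) R2 N2)
  a← m with rewireA⁻ {G} m
  ... | inj₁ (m' , n , n') = rewireA⁺ {rewire G R1 N1} (rewireA⁺ {G} m' (not1 n) (not1 n')) (not2 n) (not2 n')
  ... | inj₂ k with ∈-++⁻ (surviving R2 N1) k
  ...   | inj₂ k' = rewireNew⁺ {rewire G R1 N1} {R2} k'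
  ...   | inj₁ k' with ∈-filter⁻ (keepArc? R2) {xs = N1} k'
  ...     | k'' , n , n' = rewireA⁺ {rewire G R1 N1} (rewireNew⁺ {G} {R1} k'') n n'

∉₁ : ∀ {x y : ℕ} → x ≢ y → x ∉ y ∷ []
∉₁ n (here e) = n e

∉₂ : ∀ {x y z : ℕ} → x ≢ y → x ≢ z → x ∉ y ∷ z ∷ []
∉₂ n n' (here e) = n e
∉₂ n n' (there (here e)) = n' e

∈₁ : ∀ {A : Set} {x y : A} → x ∈ y ∷ [] → x ≡ y
∈₁ (here e) = e

delV⁺ : ∀ {G x y} → x ∈ vertices G → x ≢ y → x ∈ vertices (deleteVertex G y)
delV⁺ {G} {x} {y} m n = ∈-filter⁺ (λ z → ¬? (z ≟ y)) m n

delV⁻ : ∀ {G x y} → x ∈ vertices (deleteVertex G y) → (x ∈ vertices G) × (x ≢ y)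
delV⁻ {G} {x} {y} m = ∈-filter⁻ (λ z → ¬? (z ≟ y)) {xs = vertices G} m

delA⁺ : ∀ {G u v y} → (u , v) ∈ arcs G → u ≢ y → v ≢ y → (u , v) ∈ arcs (deleteVertex G y)
delA⁺ {G} {u} {v} {y} m n n' = ∈-filter⁺ (λ e → ¬? (proj₁ e ≟ y)) (∈-filter⁺ (λ e → ¬? (proj₂ e ≟ y)) m n') n

delA⁻ : ∀ {G u v y} → (u , v) ∈ arcs (deleteVertex G y) → ((u , v) ∈ arcs G) × (u ≢ y) × (v ≢ y)
delA⁻ {G} {u} {v} {y} m with ∈-filter⁻ (λ e → ¬? (proj₁ e ≟ y)) {xs = filter (λ e → ¬? (proj₂ e ≟ y)) (arcs G)} m
... | m' , n with ∈-filter⁻ (λ e → ¬? (proj₂ e ≟ y)) {xs = arcs G} m'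
... | m'' , n' = m'' , n , n'

deleteVertex≈rewire : ∀ G x → deleteVertex G x ≈[ idᴿ ] rewire G (x ∷ []) []
deleteVertex≈rewire G x = iso
  (λ m → let (m' , n) = delV⁻ {G} m in rewireV⁺ {G} {x ∷ []} {[]} m' (∉₁ n))
  (λ m → let (m' , n) = rewireV⁻ {G} {x ∷ []} {[]} m in delV⁺ {G} m' (λ e → n (here e)))
  (λ m → let (m' , n , n') = delA⁻ {G} m in rewireA⁺ {G} {x ∷ []} {[]} m' (∉₁ n) (∉₁ n'))
  a←
  where
  a← : ∀ {u v} → (u , v) ∈ arcs (rewire G (x ∷ []) []) → (u , v) ∈ arcs (deleteVertex G x)
  a← m with rewireA⁻ {G} {x ∷ []} {[]} m
  ... | inj₁ (m' , n , n') = delA⁺ {G} m' (λ e → n (here e)) (λ e → n' (here e))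
  ... | inj₂ ()

wellFormed-deleteVertex : ∀ {G} x → WellFormed G → WellFormed (deleteVertex G x)
wellFormed-deleteVertex {G} x (uniqueV , uniqueA) = filter⁺ _ uniqueV , filter⁺ _ (filter⁺ _ uniqueA)

delArc⁺ : ∀ {G e d} → e ∈ arcs G → e ≢ d → e ∈ arcs (deleteArc G d)
delArc⁺ {G} {e} {d} m n = ∈-filter⁺ (λ f → ¬? (f ≟ₐ d)) m n

delArc⁻ : ∀ {G e d} → e ∈ arcs (deleteArc G d) → (e ∈ arcs G) × (e ≢ d)
delArc⁻ {G} {e} {d} m = ∈-filter⁻ (λ f → ¬? (f ≟ₐ d)) {xs = arcs G} m

wellFormed-deleteArc : ∀ {G} d → WellFormed G → WellFormed (deleteArc G d)
wellFormed-deleteArc {G} d (uniqueV , uniqueA) = uniqueV , filter⁺ _ uniqueA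

inArcs≡singleton : ∀ {G v p} → indeg G v ≡ 1 → (p , v) ∈ arcs G → inArcs G v ≡ (p , v) ∷ []
inArcs≡singleton {G} {v} {p} e m with inArcs G v | ∈-filter⁺ (λ e → proj₂ e ≟ v) {xs = arcs G} m refl
... | x ∷ [] | here refl = refl
... | [] | ()
... | _ ∷ _ ∷ _ | _ with e
... | ()

outArcs≡singleton : ∀ {G v c} → outdeg G v ≡ 1 → (v , c) ∈ arcs G → outArcs G v ≡ (v , c) ∷ []
outArcs≡singleton {G} {v} {c} e m with outArcs G v | ∈-filter⁺ (λ e → proj₁ e ≟ v) {xs = arcs G} m refl
... | x ∷ [] | here refl = refl
... | [] | ()
... | _ ∷ _ ∷ _ | _ with e
... | ()

bypass : Graph → ℕ → ℕ → ℕ → Graph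
bypass G v p c = mkGraph (vertices (deleteVertex G v)) (arcs (deleteVertex G v) ++ [ (p , c) ])

suppress-bypass : ∀ G v p c → inArcs G v ≡ (p , v) ∷ [] → outArcs G v ≡ (v , c) ∷ [] →
  suppress G v ≡ bypass G v p c
suppress-bypass G v p c e1 e2 rewrite e1 | e2 = refl

suppress-id : ∀ G v → ¬ (indeg G v ≡ 1 × outdeg G v ≡ 1) → suppress G v ≡ G
suppress-id G v n with inArcs G v | outArcs G v
... | [] | _ = refl
... | _ ∷ _ ∷ _ | _ = refl
... | _ ∷ [] | [] = refl
... | _ ∷ [] | _ ∷ _ ∷ _ = refl
... | (p , _) ∷ [] | (_ , c) ∷ [] = ⊥-elim (n (refl , refl))

bypass≈rewire : ∀ G v p c → bypass G v p c ≈[ idᴿ ] rewire G (v ∷ []) ((p , c) ∷ [])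
bypass≈rewire G v p c = iso
  (λ m → let (m' , n) = delV⁻ {G} m in rewireV⁺ {G} {v ∷ []} {(p , c) ∷ []} m' (∉₁ n))
  (λ m → let (m' , n) = rewireV⁻ {G} {v ∷ []} {(p , c) ∷ []} m in delV⁺ {G} m' (λ e → n (here e)))
  a→ a←
  where
  a→ : ∀ {u w} → (u , w) ∈ arcs (bypass G v p c) → (u , w) ∈ arcs (rewire G (v ∷ []) ((p , c) ∷ []))
  a→ m with ∈-++⁻ (arcs (deleteVertex G v)) m
  ... | inj₂ k = rewireNew⁺ {G} {v ∷ []} k
  ... | inj₁ k = let (m' , n , n') = delA⁻ {G} k in rewireA⁺ {G} {v ∷ []} {(p , c) ∷ []} m' (∉₁ n) (∉₁ n')
  a← : ∀ {u w} → (u , w) ∈ arcs (rewire G (v ∷ []) ((p , c) ∷ [])) → (u , w) ∈ arcs (bypass G v p c)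
  a← m with rewireA⁻ {G} {v ∷ []} {(p , c) ∷ []} m
  ... | inj₁ (m' , n , n') = ∈-++⁺ˡ (delA⁺ {G} m' (λ e → n (here e)) (λ e → n' (here e)))
  ... | inj₂ k = ∈-++⁺ʳ (arcs (deleteVertex G v)) k

wellFormed-bypass : ∀ {G} v p c → WellFormed G → (p , c) ∉ arcs G → WellFormed (bypass G v p c)
wellFormed-bypass {G} v p c (uniqueV , uniqueA) n = filter⁺ _ uniqueV ,
  ++⁺ (filter⁺ _ (filter⁺ _ uniqueA)) ([] ∷ []) (λ { (m , here refl) → n (proj₁ (delA⁻ {G} m)) })

wellFormed-rewire : ∀ {G} R New → WellFormed G → Unique New → (∀ {e} → e ∈ New → e ∉ arcs G) → WellFormed (rewire G R New)
wellFormed-rewire {G} R New (uniqueV , uniqueA) uN n = filter⁺ _ uniqueV ,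
  ++⁺ (filter⁺ _ uniqueA) uN (λ { (m , m') → n m' (proj₁ (∈-filter⁻ (keepArc? R) {xs = arcs G} m)) })

rewire-deleteArc : ∀ N d R X → proj₁ d ∈ R → rewire (deleteArc N d) R X ≈[ idᴿ ] rewire N R X
rewire-deleteArc N d R X dm = iso
  (λ m → let (m' , n) = rewireV⁻ {deleteArc N d} {R} {X} m in rewireV⁺ {N} {R} {X} m' n)
  (λ m → let (m' , n) = rewireV⁻ {N} {R} {X} m in rewireV⁺ {deleteArc N d} {R} {X} m' n)
  a→ a←
  where
  a→ : ∀ {u v} → (u , v) ∈ arcs (rewire (deleteArc N d) R X) → (u , v) ∈ arcs (rewire N R X)
  a→ m with rewireA⁻ {deleteArc N d} {R} {X} m
  ... | inj₁ (m' , n , n') = rewireA⁺ {N} {R} {X} (proj₁ (delArc⁻ {N} m')) n n'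
  ... | inj₂ k = rewireNew⁺ {N} {R} k
  a← : ∀ {u v} → (u , v) ∈ arcs (rewire N R X) → (u , v) ∈ arcs (rewire (deleteArc N d) R X)
  a← m with rewireA⁻ {N} {R} {X} m
  ... | inj₁ (m' , n , n') = rewireA⁺ {deleteArc N d} {R} {X} (delArc⁺ {N} m' (λ { refl → n dm })) n n'
  ... | inj₂ k = rewireNew⁺ {deleteArc N d} {R} k

SameType : Graph → Graph → ℕ → Set
SameType N M x = ((indeg M x ≡ indeg N x) × (outdeg M x ≡ outdeg N x)) ⊎ (IsReticulation N x × IsReticulation M x)

module RewireNetwork {N : Graph} (nt : ProperNetwork N) (R : List ℕ) (New : List Arc) where
  open ProperNetwork nt
  open NetworkFacts nt
  M : Graph
  M = rewire N R New

  module _ (root∉ : root ∉ R) (uniqueNew : Unique New) (new∉N : ∀ {e} → e ∈ New → e ∉ arcs N)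
           (newEnds : ∀ {u v} → (u , v) ∈ New → (u ∈ vertices N) × (u ∉ R) × (v ∈ vertices N) × (v ∉ R))
           (newPath : ∀ {u v} → (u , v) ∈ New → Path⁺ N u v)
           (newLeaf : ∀ {u v} → (u , v) ∈ New → outdeg N v ≡ 0)
           (sameType : ∀ x → x ∈ vertices N → x ∉ R → SameType N M x) where

    gM : WellFormed M
    gM = wellFormed-rewire R New (uniqueV , uniqueA) uniqueNew new∉N

    sameType-root : (indeg M root ≡ indeg N root) × (outdeg M root ≡ outdeg N root)
    sameType-root with sameType root root∈ root∉
    ... | inj₁ k = k
    ... | inj₂ (rt , _) = ⊥-elim (reticulation≢root rt refl)

    rewire-network : IsNetwork M
    rewire-network = inj₂ (proj₁ gM , proj₂ gM , ends' , acyc' , root , rewireV⁺ {N} {R} {New} root∈ root∉ ,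
                 trans (proj₁ sameType-root) root-indeg , trans (proj₂ sameType-root) root-outdeg , rootU' , cls')
      where
      ends' : ∀ u v → (u , v) ∈ arcs M → (u ∈ vertices M) × (v ∈ vertices M)
      ends' u v m with rewireA⁻ {N} {R} {New} m
      ... | inj₁ (m' , n , n') = rewireV⁺ {N} {R} {New} (tailV m') n , rewireV⁺ {N} {R} {New} (headV m') n'
      ... | inj₂ k with newEnds k
      ...   | um , un , vm , vn = rewireV⁺ {N} {R} {New} um un , rewireV⁺ {N} {R} {New} vm vn
      acyc' : Acyclic M
      acyc' v p = acyclic v (Path⁺-simulate {N} {M} k p)
        where k : ∀ {u w} → (u , w) ∈ arcs M → Path⁺ N u w
              k m with rewireA⁻ {N} {R} {New} m
              ... | inj₁ (m' , _) = edge m'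
              ... | inj₂ k' = newPath k'
      rootU' : ∀ v → v ∈ vertices M → indeg M v ≡ 0 → v ≡ root
      rootU' v m e with rewireV⁻ {N} {R} {New} m
      ... | m' , n with sameType v m' n
      ...   | inj₁ (i , _) = root-unique v m' (trans (sym i) e)
      ...   | inj₂ (_ , (i2 , _)) with subst (2 ≤_) e i2
      ...     | ()
      cls' : ∀ v → v ∈ vertices M → v ≢ root → IsLeafDeg M v ⊎ IsTreeVertex M v ⊎ IsReticulation M v
      cls' v m n with rewireV⁻ {N} {R} {New} m
      ... | m' , nR with sameType v m' nR
      ...   | inj₂ (_ , rt) = inj₂ (inj₂ rt)
      ...   | inj₁ (i , o) with classify v m' n
      ...     | inj₁ (o' , i') = inj₁ (trans o o' , trans i i')
      ...     | inj₂ (inj₁ (i' , o')) = inj₂ (inj₁ (trans i i' , trans o o'))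
      ...     | inj₂ (inj₂ (i' , o')) = inj₂ (inj₂ (subst (2 ≤_) (sym i) i' , trans o o'))

    reticulation-reflect : ∀ {x} → x ∈ vertices N → x ∉ R → IsReticulation M x → IsReticulation N x
    reticulation-reflect {x} m n (i , o) with sameType x m n
    ... | inj₂ (rt , _) = rt
    ... | inj₁ (i' , o') = subst (2 ≤_) i' i , trans (sym o') o

    rewire-stackFree : StackFree N → StackFree M
    rewire-stackFree sf u v (ru , rv , m) with rewireA⁻ {N} {R} {New} m
    ... | inj₁ (m' , n , n') = sf u v (reticulation-reflect (tailV m') n ru , reticulation-reflect (headV m') n' rv , m')
    ... | inj₂ k with newEnds k
    ...   | _ , _ , vm , vn with reticulation-reflect vm vn rv
    ...     | (_ , o) = 0≢1 (trans (sym (newLeaf k)) o)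

-- Reductions as rewirings

reduceCherry-nonRoot : ∀ N a b p → indeg N p ≢ 0 → reduceCherry N a b p ≡ suppress (deleteVertex N b) p
reduceCherry-nonRoot N a b p n with indeg N p ≟ 0
... | yes e = ⊥-elim (n e)
... | no _ = refl

reduceCherry-root : ∀ N a b p → indeg N p ≡ 0 → reduceCherry N a b p ≡ mkGraph (a ∷ []) []
reduceCherry-root N a b p e with indeg N p ≟ 0
... | yes _ = refl
... | no n = ⊥-elim (n e)

module CherryAsRewire {N : Graph} (nt : ProperNetwork N) where
  open ProperNetwork nt
  open NetworkFacts nt

  wellFormed : WellFormed N
  wellFormed = uniqueV , uniqueA

  reduceCherry≈rewire : ∀ {a b p q} → IsCherry N a b p → (q , p) ∈ arcs N →
    (reduceCherry N a b p ≈[ idᴿ ] rewire N (b ∷ p ∷ []) ((q , a) ∷ [])) × WellFormed (reduceCherry N a b p)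
  reduceCherry≈rewire {a} {b} {p} {q} (a≢b , la@(am , ao) , (bm , bo) , ma , mb) mq =
    ≈-subst eqR (≈-trans (bypass≈rewire D p q a)
      (≈-trans (rewire-cong {β = idᴿ} {R = p ∷ []} {New = (q , a) ∷ []} (deleteVertex≈rewire N b) (λ m → m) (λ m → m) (λ m → m) (λ m → m))
               (rewire-∘ N (b ∷ []) [] (p ∷ []) ((q , a) ∷ [])))) ,
    subst WellFormed (sym eqR) (wellFormed-bypass p q a (wellFormed-deleteVertex b wellFormed) qa∉)
    where
    D : Graph
    D = deleteVertex N b
    p≢b : p ≢ b
    p≢b e = leaf≢tail bo ma (sym e)
    o2 : outdeg N p ≡ 2
    o2 = twoChildren⇒outdeg≡2 ma mb a≢b
    inD : indeg D p ≡ 1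
    inD = trans (indeg-cong {D} {N} (proj₂ (wellFormed-deleteVertex b wellFormed)) uniqueA (λ m → proj₁ (delA⁻ {N} m))
                   (λ {u} m → delA⁺ {N} m (λ e → leaf≢tail bo m (sym e)) p≢b)) (outdeg≡2⇒indeg≡1 o2 mq)
    outD : outdeg D p ≡ 1
    outD = uniqueChild⇒outdeg≡1 {D} (proj₂ (wellFormed-deleteVertex b wellFormed)) (delA⁺ {N} ma p≢b (λ e → a≢b e)) k
      where k : ∀ {u} → (p , u) ∈ arcs D → u ≡ a
            k m with delA⁻ {N} m
            ... | m' , _ , u≢b with outdeg≡2⇒children {N} o2 ma mb a≢b m'
            ...   | inj₁ e = e
            ...   | inj₂ e = ⊥-elim (u≢b e)
    eqR : reduceCherry N a b p ≡ bypass D p q a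
    eqR = trans (reduceCherry-nonRoot N a b p (λ e → indeg≡0⇒∉ {N} e mq))
      (suppress-bypass D p q a (inArcs≡singleton {D} inD (delA⁺ {N} mq (λ e → leaf≢tail bo mq (sym e)) p≢b))
                            (outArcs≡singleton {D} outD (delA⁺ {N} ma p≢b (λ e → a≢b e))))
    qa∉ : (q , a) ∉ arcs D
    qa∉ m with leaf-uniqueParent la ma (proj₁ (delA⁻ {N} m))
    ... | refl = noLoop mq

module CutAsRewire {N : Graph} (nt : ProperNetwork N) {a b pa pb ga : ℕ} (rc : IsReticulatedCherry N a b pa pb) (mga : (ga , pa) ∈ arcs N) where
  open ProperNetwork nt
  open NetworkFacts nt
  open CherryAsRewire nt using (wellFormed)

  open RetCherry rc

  pa≢pb : pa ≢ pb
  pa≢pb refl = noLoop mab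
  a≢pb : a ≢ pb
  a≢pb refl = 0≢1 (trans (sym ao) ro)
  pa≢a : pa ≢ a
  pa≢a e = leaf≢tail ao ma (sym e)
  pa≢b : pa ≢ b
  pa≢b e = leaf≢tail bo ma (sym e)
  pb≢b : pb ≢ b
  pb≢b e = leaf≢tail bo mb (sym e)
  ga≢pa : ga ≢ pa
  ga≢pa refl = noLoop mga
  pbch : ∀ {u} → (pb , u) ∈ arcs N → u ≡ b
  pbch m = outdeg≡1⇒child≡ {N} ro m mb
  ga≢pb : ga ≢ pb
  ga≢pb refl = pa≢b (pbch mga)
  o2 : outdeg N pa ≡ 2
  o2 = twoChildren⇒outdeg≡2 ma mab a≢pb
  pach : ∀ {u} → (pa , u) ∈ arcs N → u ≡ a ⊎ u ≡ pb
  pach = outdeg≡2⇒children {N} o2 ma mab a≢pb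

  E : Graph
  E = deleteArc N (pa , pb)
  gE : WellFormed E
  gE = wellFormed-deleteArc (pa , pb) wellFormed
  inE : indeg E pa ≡ 1
  inE = trans (indeg-cong {E} {N} (proj₂ gE) uniqueA (λ m → proj₁ (delArc⁻ {N} m)) (λ m → delArc⁺ {N} m (λ e → pa≢pb (cong proj₂ e))))
          (outdeg≡2⇒indeg≡1 o2 mga)
  outE : outdeg E pa ≡ 1
  outE = uniqueChild⇒outdeg≡1 {E} (proj₂ gE) (delArc⁺ {N} ma (λ e → a≢pb (cong proj₂ e))) k
    where k : ∀ {u} → (pa , u) ∈ arcs E → u ≡ a
          k m with delArc⁻ {N} m
          ... | m' , n with pach m'
          ...   | inj₁ e = e
          ...   | inj₂ refl = ⊥-elim (n refl)
  S1 : Graph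
  S1 = bypass E pa ga a
  eqS1 : suppress E pa ≡ S1
  eqS1 = suppress-bypass E pa ga a (inArcs≡singleton {E} inE (delArc⁺ {N} mga (λ e → ga≢pa (cong proj₁ e))))
                                 (outArcs≡singleton {E} outE (delArc⁺ {N} ma (λ e → a≢pb (cong proj₂ e))))
  gS1 : WellFormed S1
  gS1 = wellFormed-bypass pa ga a gE k
    where k : (ga , a) ∉ arcs E
          k m with leaf-uniqueParent la ma (proj₁ (delArc⁻ {N} m))
          ... | refl = noLoop mga
  M1 : Graph
  M1 = rewire N (pa ∷ []) ((ga , a) ∷ [])
  S1≈M1 : S1 ≈[ idᴿ ] M1
  S1≈M1 = ≈-trans (bypass≈rewire E pa ga a) (rewire-deleteArc N (pa , pb) (pa ∷ []) ((ga , a) ∷ []) (here refl))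
  inS1 : ∀ {u v} → (u , v) ∈ arcs S1 → (((u , v) ∈ arcs N) × (u ≢ pa) × (v ≢ pa)) ⊎ ((u , v) ≡ (ga , a))
  inS1 m with rewireA⁻ {N} {pa ∷ []} {(ga , a) ∷ []} (_≈[_]_.a→ S1≈M1 m)
  ... | inj₁ (m' , n , n') = inj₁ (m' , (λ e → n (here e)) , (λ e → n' (here e)))
  ... | inj₂ (here e) = inj₂ e
  toS1 : ∀ {u v} → (u , v) ∈ arcs N → u ≢ pa → v ≢ pa → (u , v) ∈ arcs S1
  toS1 m n n' = _≈[_]_.a← S1≈M1 (rewireA⁺ {N} {pa ∷ []} {(ga , a) ∷ []} m (∉₁ n) (∉₁ n'))
  pbin : indeg N pb ≡ suc (indeg S1 pb)
  pbin = indeg≡suc {N} {S1} {pb} {pb} {pa} uniqueA (proj₂ gS1) f g mab k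
    where
    f : ∀ {u} → (u , pb) ∈ arcs N → (u , pb) ∈ arcs S1 ⊎ u ≡ pa
    f {u} m with u ≟ pa
    ... | yes e = inj₂ e
    ... | no n = inj₁ (toS1 m n (λ e → pa≢pb (sym e)))
    g : ∀ {u} → (u , pb) ∈ arcs S1 → (u , pb) ∈ arcs N
    g m with inS1 m
    ... | inj₁ (m' , _) = m'
    ... | inj₂ refl = ⊥-elim (a≢pb refl)
    k : (pa , pb) ∉ arcs S1
    k m with inS1 m
    ... | inj₁ (_ , n , _) = n refl
    ... | inj₂ refl = ga≢pa refl
  outS1 : outdeg S1 pb ≡ 1
  outS1 = uniqueChild⇒outdeg≡1 {S1} (proj₂ gS1) (toS1 mb (λ e → pa≢pb (sym e)) (λ e → pa≢b (sym e))) k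
    where k : ∀ {u} → (pb , u) ∈ arcs S1 → u ≡ b
          k m with inS1 m
          ... | inj₁ (m' , _) = pbch m'
          ... | inj₂ refl = ⊥-elim (ga≢pb refl)

  cut≡ : cutReticulatedCherry N pa pb ≡ suppress S1 pb
  cut≡ = cong (λ G → suppress G pb) eqS1

  cut≈rewire-keep : 3 ≤ indeg N pb → (cutReticulatedCherry N pa pb ≈[ idᴿ ] M1) × WellFormed (cutReticulatedCherry N pa pb)
  cut≈rewire-keep le = ≈-subst eq S1≈M1 , subst WellFormed (sym eq) gS1
    where
    eq : cutReticulatedCherry N pa pb ≡ S1
    eq = trans cut≡ (suppress-id S1 pb (λ { (i , _) → k i }))
      where k : indeg S1 pb ≡ 1 → ⊥
            k i = 3≰2 (subst (3 ≤_) (trans pbin (cong suc i)) le)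

  M2 : ℕ → Graph
  M2 qb = rewire N (pa ∷ pb ∷ []) ((ga , a) ∷ (qb , b) ∷ [])

  cut≈rewire-suppress : ∀ {qb} → indeg N pb ≡ 2 → (qb , pb) ∈ arcs N → qb ≢ pa →
    (cutReticulatedCherry N pa pb ≈[ idᴿ ] M2 qb) × WellFormed (cutReticulatedCherry N pa pb)
  cut≈rewire-suppress {qb} i2 mq qn = ≈-subst eq (≈-trans (bypass≈rewire S1 pb qb b)
      (≈-trans (rewire-cong {β = idᴿ} {R = pb ∷ []} {R' = pb ∷ []} {New = (qb , b) ∷ []} S1≈M1 (λ m → m) (λ m → m) (λ m → m) (λ m → m))
       (≈-trans (rewire-∘ N (pa ∷ []) ((ga , a) ∷ []) (pb ∷ []) ((qb , b) ∷ []))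
         (rewire-cong {G = N} {H = N} {β = idᴿ} {R = pa ∷ pb ∷ []} ≈-refl (λ m → m) (λ m → m) n→ n←)))) ,
    subst WellFormed (sym eq) (wellFormed-bypass pb qb b gS1 qb∉)
    where
    inS : indeg S1 pb ≡ 1
    inS = suc-injective (trans (sym pbin) i2)
    mqS : (qb , pb) ∈ arcs S1
    mqS = toS1 mq qn (λ e → pa≢pb (sym e))
    eq : cutReticulatedCherry N pa pb ≡ bypass S1 pb qb b
    eq = trans cut≡ (suppress-bypass S1 pb qb b (inArcs≡singleton {S1} inS mqS)
                     (outArcs≡singleton {S1} outS1 (toS1 mb (λ e → pa≢pb (sym e)) (λ e → pa≢b (sym e)))))
    qb∉ : (qb , b) ∉ arcs S1
    qb∉ m with inS1 m
    ... | inj₁ (m' , _) with leaf-uniqueParent lb mb m'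
    ...   | refl = noLoop mq
    qb∉ m | inj₂ refl = a≢b refl
    n→ : ∀ {u v} → (u , v) ∈ surviving (pb ∷ []) ((ga , a) ∷ []) ++ (qb , b) ∷ [] → (u , v) ∈ (ga , a) ∷ (qb , b) ∷ []
    n→ m with ∈-++⁻ (surviving (pb ∷ []) ((ga , a) ∷ [])) m
    ... | inj₂ k = there k
    ... | inj₁ k = here (∈₁ (proj₁ (∈-filter⁻ (keepArc? (pb ∷ [])) {xs = (ga , a) ∷ []} k)))
    n← : ∀ {u v} → (u , v) ∈ (ga , a) ∷ (qb , b) ∷ [] → (u , v) ∈ surviving (pb ∷ []) ((ga , a) ∷ []) ++ (qb , b) ∷ []
    n← (here refl) = ∈-++⁺ˡ (∈-filter⁺ (keepArc? (pb ∷ [])) (here refl) (∉₁ ga≢pb , ∉₁ a≢pb))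
    n← (there k) = ∈-++⁺ʳ (surviving (pb ∷ []) ((ga , a) ∷ [])) k

module CherryRewire {N : Graph} (nt : ProperNetwork N) {a b p q : ℕ} (ch : IsCherry N a b p) (mq : (q , p) ∈ arcs N) where
  open ProperNetwork nt
  open NetworkFacts nt

  open Cherry ch

  R : List ℕ
  R = b ∷ p ∷ []
  New : List Arc
  New = (q , a) ∷ []
  M : Graph
  M = rewire N R New

  p≢b : p ≢ b
  p≢b e = leaf≢tail bo ma (sym e)
  p≢a : p ≢ a
  p≢a e = leaf≢tail ao ma (sym e)
  q≢p : q ≢ p
  q≢p refl = noLoop mq
  q≢b : q ≢ b
  q≢b e = leaf≢tail bo mq (sym e)
  o2 : outdeg N p ≡ 2
  o2 = twoChildren⇒outdeg≡2 ma mb a≢b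
  pch : ∀ {u} → (p , u) ∈ arcs N → u ≡ a ⊎ u ≡ b
  pch = outdeg≡2⇒children {N} o2 ma mb a≢b
  ppar : ∀ {u} → (u , p) ∈ arcs N → u ≡ q
  ppar m = indeg≡1⇒parent≡ {N} (outdeg≡2⇒indeg≡1 o2 mq) m mq
  apar : ∀ {u} → (u , a) ∈ arcs N → u ≡ p
  apar = leaf-uniqueParent la ma
  bpar : ∀ {u} → (u , b) ∈ arcs N → u ≡ p
  bpar = leaf-uniqueParent lb mb

  root∉ : root ∉ R
  root∉ = ∉₂ (λ e → head≢root mb (sym e)) (λ e → head≢root mq (sym e))
  uniqueNew : Unique New
  uniqueNew = [] ∷ []
  new∉N : ∀ {e} → e ∈ New → e ∉ arcs N
  new∉N (here refl) m = q≢p (apar m)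
  newEnds : ∀ {u v} → (u , v) ∈ New → (u ∈ vertices N) × (u ∉ R) × (v ∈ vertices N) × (v ∉ R)
  newEnds (here refl) = tailV mq , ∉₂ q≢b q≢p , headV ma , ∉₂ (λ e → a≢b e) (λ e → p≢a (sym e))
  newPath : ∀ {u v} → (u , v) ∈ New → Path⁺ N u v
  newPath (here refl) = step mq (edge ma)
  newLeaf : ∀ {u v} → (u , v) ∈ New → outdeg N v ≡ 0
  newLeaf (here refl) = ao

  gM : WellFormed M
  gM = wellFormed-rewire R New (uniqueV , uniqueA) uniqueNew new∉N

  sameType : ∀ x → x ∈ vertices N → x ∉ R → SameType N M x
  sameType x xm xn = inj₁ (indeg-eq , outdeg-cong-bij {M} {N} (replace a p) (replace p a) (proj₂ gM) uniqueA f g)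
    where
    x≢b : x ≢ b
    x≢b e = xn (here e)
    x≢p : x ≢ p
    x≢p e = xn (there (here e))
    f : ∀ {u} → (x , u) ∈ arcs M → ((x , replace a p u) ∈ arcs N) × (replace p a (replace a p u) ≡ u)
    f {u} m with rewireA⁻ {N} {R} {New} m
    ... | inj₂ (here refl) = subst (λ z → (q , z) ∈ arcs N) (sym (replace-≡ a p)) mq ,
                             trans (cong (replace p a) (replace-≡ a p)) (replace-≡ p a)
    ... | inj₁ (m' , _ , un) with u ≟ a
    ...   | yes refl = ⊥-elim (x≢p (apar m'))
    ...   | no u≢a = m' , replace-≢ (λ e → un (there (here e)))
    g : ∀ {v} → (x , v) ∈ arcs N → ((x , replace p a v) ∈ arcs M) × (replace a p (replace p a v) ≡ v)
    g {v} m with v ≟ p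
    ... | yes e = subst (λ z → (z , a) ∈ arcs M) (sym (ppar (subst (λ z → (x , z) ∈ arcs N) e m))) (rewireNew⁺ {N} {R} (here refl)) ,
                  trans (replace-≡ a p) (sym e)
    ... | no v≢p with v ≟ b
    ...   | yes refl = ⊥-elim (x≢p (bpar m))
    ...   | no v≢b with v ≟ a
    ...     | yes refl = ⊥-elim (x≢p (apar m))
    ...     | no v≢a = rewireA⁺ {N} {R} {New} m xn (∉₂ v≢b v≢p) , refl
    indeg-eq : indeg M x ≡ indeg N x
    indeg-eq with x ≟ a
    ... | yes refl = trans (uniqueParent⇒indeg≡1 {M} (proj₂ gM) (rewireNew⁺ {N} {R} (here refl)) k) (sym (leaf-indeg≡1 (am , ao)))
      where k : ∀ {u} → (u , a) ∈ arcs M → u ≡ q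
            k m with rewireA⁻ {N} {R} {New} m
            ... | inj₁ (m' , un , _) = ⊥-elim (un (there (here (apar m'))))
            ... | inj₂ (here refl) = refl
    ... | no x≢a = indeg-cong {M} {N} (proj₂ gM) uniqueA k k'
      where
      k : ∀ {u} → (u , x) ∈ arcs M → (u , x) ∈ arcs N
      k m with rewireA⁻ {N} {R} {New} m
      ... | inj₁ (m' , _) = m'
      ... | inj₂ (here refl) = ⊥-elim (x≢a refl)
      k' : ∀ {u} → (u , x) ∈ arcs N → (u , x) ∈ arcs M
      k' {u} m = rewireA⁺ {N} {R} {New} m un xn
        where un : u ∉ R
              un (here refl) = leaf≢tail bo m refl
              un (there (here refl)) with pch m
              ... | inj₁ e = x≢a e
              ... | inj₂ e = x≢b e

  open RewireNetwork nt R New using (rewire-network; rewire-stackFree)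
  rewire-isNetwork : IsNetwork M
  rewire-isNetwork = rewire-network root∉ uniqueNew new∉N newEnds newPath newLeaf sameType
  rewire-isStackFree : StackFree N → StackFree M
  rewire-isStackFree = rewire-stackFree root∉ uniqueNew new∉N newEnds newPath newLeaf sameType

module CutRewire {N : Graph} (nt : ProperNetwork N) {a b pa pb ga : ℕ} (rc : IsReticulatedCherry N a b pa pb) (mga : (ga , pa) ∈ arcs N) where
  open ProperNetwork nt
  open NetworkFacts nt
  open CutAsRewire nt rc mga

  open RetCherry rc

  apar : ∀ {u} → (u , a) ∈ arcs N → u ≡ pa
  apar = leaf-uniqueParent la ma
  bpar : ∀ {u} → (u , b) ∈ arcs N → u ≡ pb
  bpar = leaf-uniqueParent lb mb
  papar : ∀ {u} → (u , pa) ∈ arcs N → u ≡ ga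
  papar m = indeg≡1⇒parent≡ {N} (outdeg≡2⇒indeg≡1 o2 mga) m mga
  b≢pa : b ≢ pa
  b≢pa e = pa≢b (sym e)
  b≢pb : b ≢ pb
  b≢pb e = pb≢b (sym e)
  a≢pa : a ≢ pa
  a≢pa e = pa≢a (sym e)

  module KeepReticulation (le : 3 ≤ indeg N pb) where
    R : List ℕ
    R = pa ∷ []
    New : List Arc
    New = (ga , a) ∷ []
    M : Graph
    M = rewire N R New
    root∉ : root ∉ R
    root∉ = ∉₁ (λ e → head≢root mga (sym e))
    uniqueNew : Unique New
    uniqueNew = [] ∷ []
    new∉N : ∀ {e} → e ∈ New → e ∉ arcs N
    new∉N (here refl) m = ga≢pa (apar m)
    newEnds : ∀ {u v} → (u , v) ∈ New → (u ∈ vertices N) × (u ∉ R) × (v ∈ vertices N) × (v ∉ R)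
    newEnds (here refl) = tailV mga , ∉₁ ga≢pa , headV ma , ∉₁ a≢pa
    newPath : ∀ {u v} → (u , v) ∈ New → Path⁺ N u v
    newPath (here refl) = step mga (edge ma)
    newLeaf : ∀ {u v} → (u , v) ∈ New → outdeg N v ≡ 0
    newLeaf (here refl) = ao
    gM : WellFormed M
    gM = wellFormed-rewire R New (uniqueV , uniqueA) uniqueNew new∉N

    sameType : ∀ x → x ∈ vertices N → x ∉ R → SameType N M x
    sameType x xm xn with ≡⊎≢ x pb
    ... | inj₁ refl = inj₂ (rb , pred≤ (subst (3 ≤_) iM le) , oM)
      where
      pred≤ : ∀ {n} → 3 ≤ suc n → 2 ≤ n
      pred≤ (s≤s k) = k
      iM : indeg N pb ≡ suc (indeg M pb)
      iM = indeg≡suc {N} {M} {pb} {pb} {pa} uniqueA (proj₂ gM) f g mab k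
        where
        f : ∀ {u} → (u , pb) ∈ arcs N → (u , pb) ∈ arcs M ⊎ u ≡ pa
        f {u} m with ≡⊎≢ u pa
        ... | inj₁ e = inj₂ e
        ... | inj₂ n = inj₁ (rewireA⁺ {N} {R} {New} m (∉₁ n) xn)
        g : ∀ {u} → (u , pb) ∈ arcs M → (u , pb) ∈ arcs N
        g m with rewireA⁻ {N} {R} {New} m
        ... | inj₁ (m' , _) = m'
        ... | inj₂ (here refl) = ⊥-elim (a≢pb refl)
        k : (pa , pb) ∉ arcs M
        k m with rewireA⁻ {N} {R} {New} m
        ... | inj₁ (_ , n , _) = n (here refl)
        ... | inj₂ (here refl) = ga≢pa refl
      oM : outdeg M pb ≡ 1
      oM = uniqueChild⇒outdeg≡1 {M} (proj₂ gM) (rewireA⁺ {N} {R} {New} mb xn (∉₁ b≢pa)) k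
        where k : ∀ {u} → (pb , u) ∈ arcs M → u ≡ b
              k m with rewireA⁻ {N} {R} {New} m
              ... | inj₁ (m' , _) = pbch m'
              ... | inj₂ (here refl) = ⊥-elim (ga≢pb refl)
    ... | inj₂ x≢pb = inj₁ (indeg-eq , outdeg-cong-bij {M} {N} (replace a pa) (replace pa a) (proj₂ gM) uniqueA f g)
      where
      x≢pa : x ≢ pa
      x≢pa e = xn (here e)
      f : ∀ {u} → (x , u) ∈ arcs M → ((x , replace a pa u) ∈ arcs N) × (replace pa a (replace a pa u) ≡ u)
      f {u} m with rewireA⁻ {N} {R} {New} m
      ... | inj₂ (here refl) = subst (λ z → (ga , z) ∈ arcs N) (sym (replace-≡ a pa)) mga ,
                               trans (cong (replace pa a) (replace-≡ a pa)) (replace-≡ pa a)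
      ... | inj₁ (m' , _ , un) with u ≟ a
      ...   | yes refl = ⊥-elim (x≢pa (apar m'))
      ...   | no u≢a = m' , replace-≢ (λ e → un (here e))
      g : ∀ {v} → (x , v) ∈ arcs N → ((x , replace pa a v) ∈ arcs M) × (replace a pa (replace pa a v) ≡ v)
      g {v} m with v ≟ pa
      ... | yes e = subst (λ z → (z , a) ∈ arcs M) (sym (papar (subst (λ z → (x , z) ∈ arcs N) e m))) (rewireNew⁺ {N} {R} (here refl)) ,
                    trans (replace-≡ a pa) (sym e)
      ... | no v≢pa with v ≟ a
      ...   | yes refl = ⊥-elim (x≢pa (apar m))
      ...   | no v≢a = rewireA⁺ {N} {R} {New} m xn (∉₁ v≢pa) , refl
      indeg-eq : indeg M x ≡ indeg N x
      indeg-eq with ≡⊎≢ x a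
      ... | inj₁ refl = trans (uniqueParent⇒indeg≡1 {M} (proj₂ gM) (rewireNew⁺ {N} {R} (here refl)) k) (sym (leaf-indeg≡1 (am , ao)))
        where k : ∀ {u} → (u , a) ∈ arcs M → u ≡ ga
              k m with rewireA⁻ {N} {R} {New} m
              ... | inj₁ (m' , un , _) = ⊥-elim (un (here (apar m')))
              ... | inj₂ (here refl) = refl
      ... | inj₂ x≢a = indeg-cong {M} {N} (proj₂ gM) uniqueA k k'
        where
        k : ∀ {u} → (u , x) ∈ arcs M → (u , x) ∈ arcs N
        k m with rewireA⁻ {N} {R} {New} m
        ... | inj₁ (m' , _) = m'
        ... | inj₂ (here refl) = ⊥-elim (x≢a refl)
        k' : ∀ {u} → (u , x) ∈ arcs N → (u , x) ∈ arcs M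
        k' {u} m = rewireA⁺ {N} {R} {New} m un xn
          where un : u ∉ R
                un (here refl) with pach m
                ... | inj₁ e = x≢a e
                ... | inj₂ e = x≢pb e

    open RewireNetwork nt R New using (rewire-network; rewire-stackFree)
    rewire-isNetwork : IsNetwork M
    rewire-isNetwork = rewire-network root∉ uniqueNew new∉N newEnds newPath newLeaf sameType
    rewire-isStackFree : StackFree N → StackFree M
    rewire-isStackFree = rewire-stackFree root∉ uniqueNew new∉N newEnds newPath newLeaf sameType

  module SuppressReticulation {qb : ℕ} (i2 : indeg N pb ≡ 2) (mq : (qb , pb) ∈ arcs N) (qn : qb ≢ pa) where
    R : List ℕ
    R = pa ∷ pb ∷ []
    New : List Arc
    New = (ga , a) ∷ (qb , b) ∷ []
    M : Graph
    M = rewire N R New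
    qb≢pb : qb ≢ pb
    qb≢pb refl = noLoop mq
    pbpar : ∀ {u} → (u , pb) ∈ arcs N → u ≡ pa ⊎ u ≡ qb
    pbpar = indeg≡2⇒parents {N} i2 mab mq (≢-sym qn)
    root∉ : root ∉ R
    root∉ = ∉₂ (λ e → head≢root mga (sym e)) (λ e → reticulation≢root rb (sym e))
    uniqueNew : Unique New
    uniqueNew = ((λ e → a≢b (cong proj₂ e)) ∷ []) ∷ [] ∷ []
    new∉N : ∀ {e} → e ∈ New → e ∉ arcs N
    new∉N (here refl) m = ga≢pa (apar m)
    new∉N (there (here refl)) m = qb≢pb (bpar m)
    newEnds : ∀ {u v} → (u , v) ∈ New → (u ∈ vertices N) × (u ∉ R) × (v ∈ vertices N) × (v ∉ R)
    newEnds (here refl) = tailV mga , ∉₂ ga≢pa ga≢pb , headV ma , ∉₂ a≢pa a≢pb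
    newEnds (there (here refl)) = tailV mq , ∉₂ qn qb≢pb , headV mb , ∉₂ b≢pa b≢pb
    newPath : ∀ {u v} → (u , v) ∈ New → Path⁺ N u v
    newPath (here refl) = step mga (edge ma)
    newPath (there (here refl)) = step mq (edge mb)
    newLeaf : ∀ {u v} → (u , v) ∈ New → outdeg N v ≡ 0
    newLeaf (here refl) = ao
    newLeaf (there (here refl)) = bo
    gM : WellFormed M
    gM = wellFormed-rewire R New (uniqueV , uniqueA) uniqueNew new∉N

    φ ψ : ℕ → ℕ
    φ u = replace a pa (replace b pb u)
    ψ u = replace pa a (replace pb b u)
    φa : φ a ≡ pa
    φa = trans (cong (replace a pa) (replace-≢ a≢b)) (replace-≡ a pa)
    φb : φ b ≡ pb
    φb = trans (cong (replace a pa) (replace-≡ b pb)) (replace-≢ (λ e → a≢pb (sym e)))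
    ψpa : ψ pa ≡ a
    ψpa = trans (cong (replace pa a) (replace-≢ pa≢pb)) (replace-≡ pa a)
    ψpb : ψ pb ≡ b
    ψpb = trans (cong (replace pa a) (replace-≡ pb b)) (replace-≢ b≢pa)
    φo : ∀ {u} → u ≢ a → u ≢ b → φ u ≡ u
    φo n n' = trans (cong (replace a pa) (replace-≢ n')) (replace-≢ n)
    ψo : ∀ {u} → u ≢ pa → u ≢ pb → ψ u ≡ u
    ψo n n' = trans (cong (replace pa a) (replace-≢ n')) (replace-≢ n)

    sameType : ∀ x → x ∈ vertices N → x ∉ R → SameType N M x
    sameType x xm xn = inj₁ (indeg-eq , outdeg-cong-bij {M} {N} φ ψ (proj₂ gM) uniqueA f g)
      where
      x≢pa : x ≢ pa
      x≢pa e = xn (here e)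
      x≢pb : x ≢ pb
      x≢pb e = xn (there (here e))
      f : ∀ {u} → (x , u) ∈ arcs M → ((x , φ u) ∈ arcs N) × (ψ (φ u) ≡ u)
      f {u} m with rewireA⁻ {N} {R} {New} m
      ... | inj₂ (here refl) = subst (λ z → (ga , z) ∈ arcs N) (sym φa) mga , trans (cong ψ φa) ψpa
      ... | inj₂ (there (here refl)) = subst (λ z → (qb , z) ∈ arcs N) (sym φb) mq , trans (cong ψ φb) ψpb
      ... | inj₁ (m' , _ , un) with ≡⊎≢ u a | ≡⊎≢ u b
      ...   | inj₁ refl | _ = ⊥-elim (x≢pa (apar m'))
      ...   | inj₂ _ | inj₁ refl = ⊥-elim (x≢pb (bpar m'))
      ...   | inj₂ u≢a | inj₂ u≢b = subst (λ z → (x , z) ∈ arcs N) (sym (φo u≢a u≢b)) m' ,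
                                   trans (cong ψ (φo u≢a u≢b)) (ψo (λ e → un (here e)) (λ e → un (there (here e))))
      g : ∀ {v} → (x , v) ∈ arcs N → ((x , ψ v) ∈ arcs M) × (φ (ψ v) ≡ v)
      g {v} m with ≡⊎≢ v pa | ≡⊎≢ v pb
      ... | inj₁ refl | _ = subst (λ z → (z , ψ pa) ∈ arcs M) (sym (papar m)) (subst (λ z → (ga , z) ∈ arcs M) (sym ψpa) (rewireNew⁺ {N} {R} (here refl))) ,
                            trans (cong φ ψpa) φa
      ... | inj₂ _ | inj₁ refl with pbpar m
      ...   | inj₁ e = ⊥-elim (x≢pa e)
      ...   | inj₂ refl = subst (λ z → (qb , z) ∈ arcs M) (sym ψpb) (rewireNew⁺ {N} {R} (there (here refl))) , trans (cong φ ψpb) φb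
      g {v} m | inj₂ v≢pa | inj₂ v≢pb with ≡⊎≢ v a | ≡⊎≢ v b
      ...   | inj₁ refl | _ = ⊥-elim (x≢pa (apar m))
      ...   | inj₂ _ | inj₁ refl = ⊥-elim (x≢pb (bpar m))
      ...   | inj₂ v≢a | inj₂ v≢b = subst (λ z → (x , z) ∈ arcs M) (sym (ψo v≢pa v≢pb)) (rewireA⁺ {N} {R} {New} m xn (∉₂ v≢pa v≢pb)) ,
                                   trans (cong φ (ψo v≢pa v≢pb)) (φo v≢a v≢b)
      indeg-eq : indeg M x ≡ indeg N x
      indeg-eq with ≡⊎≢ x a | ≡⊎≢ x b
      ... | inj₁ refl | _ = trans (uniqueParent⇒indeg≡1 {M} (proj₂ gM) (rewireNew⁺ {N} {R} (here refl)) k) (sym (leaf-indeg≡1 (am , ao)))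
        where k : ∀ {u} → (u , a) ∈ arcs M → u ≡ ga
              k m with rewireA⁻ {N} {R} {New} m
              ... | inj₁ (m' , un , _) = ⊥-elim (un (here (apar m')))
              ... | inj₂ (here refl) = refl
              ... | inj₂ (there (here e)) = ⊥-elim (a≢b (cong proj₂ e))
      ... | inj₂ _ | inj₁ refl = trans (uniqueParent⇒indeg≡1 {M} (proj₂ gM) (rewireNew⁺ {N} {R} (there (here refl))) k) (sym (leaf-indeg≡1 (bm , bo)))
        where k : ∀ {u} → (u , b) ∈ arcs M → u ≡ qb
              k m with rewireA⁻ {N} {R} {New} m
              ... | inj₁ (m' , un , _) = ⊥-elim (un (there (here (bpar m'))))
              ... | inj₂ (here e) = ⊥-elim (a≢b (sym (cong proj₂ e)))
              ... | inj₂ (there (here refl)) = refl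
      ... | inj₂ x≢a | inj₂ x≢b = indeg-cong {M} {N} (proj₂ gM) uniqueA k k'
        where
        k : ∀ {u} → (u , x) ∈ arcs M → (u , x) ∈ arcs N
        k m with rewireA⁻ {N} {R} {New} m
        ... | inj₁ (m' , _) = m'
        ... | inj₂ (here refl) = ⊥-elim (x≢a refl)
        ... | inj₂ (there (here refl)) = ⊥-elim (x≢b refl)
        k' : ∀ {u} → (u , x) ∈ arcs N → (u , x) ∈ arcs M
        k' {u} m = rewireA⁺ {N} {R} {New} m un xn
          where un : u ∉ R
                un (here refl) with pach m
                ... | inj₁ e = x≢a e
                ... | inj₂ e = x≢pb e
                un (there (here refl)) = x≢b (pbch m)

    open RewireNetwork nt R New using (rewire-network; rewire-stackFree)
    rewire-isNetwork : IsNetwork M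
    rewire-isNetwork = rewire-network root∉ uniqueNew new∉N newEnds newPath newLeaf sameType
    rewire-isStackFree : StackFree N → StackFree M
    rewire-isStackFree = rewire-stackFree root∉ uniqueNew new∉N newEnds newPath newLeaf sameType

singleVertex-network : ∀ a → IsNetwork (mkGraph (a ∷ []) [])
singleVertex-network a = inj₁ (a , refl , refl)

singleVertex-stackFree : ∀ a → StackFree (mkGraph (a ∷ []) [])
singleVertex-stackFree a u v (_ , _ , ())

Inherits : Graph → Graph → Set
Inherits N N' = IsNetwork N' × (StackFree N → StackFree N')

inherits-≈ : ∀ {N M M'} → (M' ≈[ idᴿ ] M) × WellFormed M' → IsNetwork M → WellFormed M →
  (StackFree N → StackFree M) → Inherits N M'
inherits-≈ (eq , wf') net wf sf = network≈ (≈-sym eq) net wf' , λ sfN → stackfree≈ (≈-sym eq) (proj₂ wf) (proj₂ wf') (sf sfN)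

data Reduction : Set where
  reduce : ℕ → ℕ → ℕ → Reduction
  cut : ℕ → ℕ → ℕ → ℕ → Reduction

Applicable : Graph → Reduction → Set
Applicable N (reduce a b p) = IsCherry N a b p
Applicable N (cut a b pa pb) = IsReticulatedCherry N a b pa pb

apply : Graph → Reduction → Graph
apply N (reduce a b p) = reduceCherry N a b p
apply N (cut a b pa pb) = cutReticulatedCherry N pa pb

orchard-step : ∀ {N} m → Applicable N m → Orchard (apply N m) → Orchard N
orchard-step {N} (reduce a b p) v o = cherry N a b p v o
orchard-step {N} (cut a b pa pb) v o = retCut N a b pa pb v o

applicable⇒arc : ∀ {N} m → Applicable N m → Σ Arc λ e → e ∈ arcs N
applicable⇒arc (reduce a b p) v = _ , Cherry.ma v
applicable⇒arc (cut a b pa pb) v = _ , RetCherry.ma v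

applicable⇒properNetwork : ∀ {N} → IsNetwork N → ∀ m → Applicable N m → ProperNetwork N
applicable⇒properNetwork net m v = properNetwork net (proj₂ (applicable⇒arc m v))

OrchardAfter : Graph → Reduction → Set
OrchardAfter N Q = ∀ m → Applicable (apply N Q) m → Orchard (apply (apply N Q) m)

-- A reduction together with the vertices that determine it as a rewiring (rewireBy):
-- the parent q of the cherry parent p, the parent ga of the tree parent pa, and, when
-- pb has in-degree two and is suppressed by the cut, its other parent qb.
data Move : Set where
  cherryMove : (a b p q : ℕ) → Move
  cutKeep : (a b pa pb ga : ℕ) → Move
  cutSuppress : (a b pa pb ga qb : ℕ) → Move

reductionOf : Move → Reduction
reductionOf (cherryMove a b p q) = reduce a b p
reductionOf (cutKeep a b pa pb ga) = cut a b pa pb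
reductionOf (cutSuppress a b pa pb ga qb) = cut a b pa pb

deleted : Move → List ℕ
deleted (cherryMove a b p q) = b ∷ p ∷ []
deleted (cutKeep a b pa pb ga) = pa ∷ []
deleted (cutSuppress a b pa pb ga qb) = pa ∷ pb ∷ []

added : Move → List Arc
added (cherryMove a b p q) = (q , a) ∷ []
added (cutKeep a b pa pb ga) = (ga , a) ∷ []
added (cutSuppress a b pa pb ga qb) = (ga , a) ∷ (qb , b) ∷ []

Legal : Graph → Move → Set
Legal N (cherryMove a b p q) = IsCherry N a b p × ((q , p) ∈ arcs N)
Legal N (cutKeep a b pa pb ga) = IsReticulatedCherry N a b pa pb × ((ga , pa) ∈ arcs N) × (3 ≤ indeg N pb)
Legal N (cutSuppress a b pa pb ga qb) = IsReticulatedCherry N a b pa pb × ((ga , pa) ∈ arcs N) × (indeg N pb ≡ 2) × ((qb , pb) ∈ arcs N) × (qb ≢ pa)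

legal⇒applicable : ∀ {N} e → Legal N e → Applicable N (reductionOf e)
legal⇒applicable (cherryMove a b p q) (c , _) = c
legal⇒applicable (cutKeep a b pa pb ga) (c , _) = c
legal⇒applicable (cutSuppress a b pa pb ga qb) (c , _) = c

legal⇒properNetwork : ∀ {N} → IsNetwork N → ∀ e → Legal N e → ProperNetwork N
legal⇒properNetwork net e ev = applicable⇒properNetwork net (reductionOf e) (legal⇒applicable e ev)

rewireBy : Graph → Move → Graph
rewireBy N e = rewire N (deleted e) (added e)

record MoveFacts (N : Graph) (e : Move) : Set where
  field
    apply≈rewire : apply N (reductionOf e) ≈[ idᴿ ] rewireBy N e
    wellFormed-apply : WellFormed (apply N (reductionOf e))
    wellFormed-rewireBy : WellFormed (rewireBy N e)
    rewire-isNetwork : IsNetwork (rewireBy N e)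
    rewire-isStackFree : StackFree N → StackFree (rewireBy N e)
    added-tail : ∀ {u v} → (u , v) ∈ added e → Σ ℕ λ w → ((u , w) ∈ arcs N) × (outdeg N w ≢ 0)
    added-leaf : ∀ {u v} → (u , v) ∈ added e → outdeg N v ≡ 0

moveFacts : ∀ {N} → (nt : ProperNetwork N) → ∀ e → Legal N e → MoveFacts N e
moveFacts {N} nt (cherryMove a b p q) (ch , mq) = record
  { apply≈rewire = proj₁ (reduceCherry≈rewire ch mq) ; wellFormed-apply = proj₂ (reduceCherry≈rewire ch mq)
  ; wellFormed-rewireBy = gM ; rewire-isNetwork = rewire-isNetwork
  ; rewire-isStackFree = rewire-isStackFree ; added-tail = nt' ; added-leaf = newLeaf }
  where
  open CherryAsRewire nt
  open CherryRewire nt ch mq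
  nt' : ∀ {u v} → (u , v) ∈ added (cherryMove a b p q) → Σ ℕ λ w → ((u , w) ∈ arcs N) × (outdeg N w ≢ 0)
  nt' (here refl) = p , mq , λ o → NetworkFacts.leaf≢tail nt o (Cherry.ma ch) refl
moveFacts {N} nt (cutKeep a b pa pb ga) (rc , mga , le) = record
  { apply≈rewire = proj₁ (cut≈rewire-keep le) ; wellFormed-apply = proj₂ (cut≈rewire-keep le)
  ; wellFormed-rewireBy = gM ; rewire-isNetwork = rewire-isNetwork
  ; rewire-isStackFree = rewire-isStackFree ; added-tail = nt' ; added-leaf = newLeaf }
  where
  open CutAsRewire nt rc mga
  open CutRewire nt rc mga
  open KeepReticulation le
  nt' : ∀ {u v} → (u , v) ∈ added (cutKeep a b pa pb ga) → Σ ℕ λ w → ((u , w) ∈ arcs N) × (outdeg N w ≢ 0)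
  nt' (here refl) = pa , mga , λ o → NetworkFacts.leaf≢tail nt o (RetCherry.ma rc) refl
moveFacts {N} nt (cutSuppress a b pa pb ga qb) (rc , mga , i2 , mq , qn) = record
  { apply≈rewire = proj₁ (cut≈rewire-suppress i2 mq qn) ; wellFormed-apply = proj₂ (cut≈rewire-suppress i2 mq qn)
  ; wellFormed-rewireBy = gM ; rewire-isNetwork = rewire-isNetwork
  ; rewire-isStackFree = rewire-isStackFree ; added-tail = nt' ; added-leaf = newLeaf }
  where
  open CutAsRewire nt rc mga
  open CutRewire nt rc mga
  open SuppressReticulation i2 mq qn
  nt' : ∀ {u v} → (u , v) ∈ added (cutSuppress a b pa pb ga qb) → Σ ℕ λ w → ((u , w) ∈ arcs N) × (outdeg N w ≢ 0)
  nt' (here refl) = pa , mga , λ o → NetworkFacts.leaf≢tail nt o (RetCherry.ma rc) refl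
  nt' (there (here refl)) = pb , mq , λ o → NetworkFacts.leaf≢tail nt o (RetCherry.mb rc) refl

NotRootCherry : Graph → Reduction → Set
NotRootCherry N P = ∀ {a b p} → P ≡ reduce a b p → indeg N p ≢ 0

extendToMove : ∀ {N} → ProperNetwork N → ∀ m → Applicable N m → NotRootCherry N m → Σ Move λ e → (reductionOf e ≡ m) × Legal N e
extendToMove {N} nt (reduce a b p) v nr with indeg≢0⇒parent {N} {p} (nr refl)
... | q , mq = cherryMove a b p q , refl , v , mq
extendToMove {N} nt (cut a b pa pb) v nr with NetworkFacts.treeParent-hasParent nt v
... | ga , mga with 2≤⇒≡2⊎3≤ (RetCherry.ri v) 
...   | inj₂ le = cutKeep a b pa pb ga , refl , v , mga , le
...   | inj₁ i2 with indeg≥2⇒otherParent {N} {pb} pa (ProperNetwork.uniqueA nt) (RetCherry.ri v)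
...     | qb , qn , mq = cutSuppress a b pa pb ga qb , refl , v , mga , i2 , mq , qn

move-inherits : ∀ {N} → ProperNetwork N → ∀ e → Legal N e → Inherits N (apply N (reductionOf e))
move-inherits {N} nt e ev = inherits-≈ {N} (apply≈rewire , wellFormed-apply) rewire-isNetwork wellFormed-rewireBy rewire-isStackFree
  where open MoveFacts (moveFacts nt e ev)

extension-inherits : ∀ {N m} → ProperNetwork N → (Σ Move λ e → (reductionOf e ≡ m) × Legal N e) → Inherits N (apply N m)
extension-inherits nt (e , refl , ev) = move-inherits nt e ev

apply-inherits : ∀ {N} → IsNetwork N → ∀ m → Applicable N m → Inherits N (apply N m)
apply-inherits {N} net (reduce a b p) c with ≡⊎≢ (indeg N p) 0
... | inj₁ p-root = subst (Inherits N) (sym (reduceCherry-root N a b p p-root)) (singleVertex-network a , λ _ → singleVertex-stackFree a)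
... | inj₂ p-nonRoot = extension-inherits nt (extendToMove nt (reduce a b p) c (λ { refl → p-nonRoot }))
  where
  nt : ProperNetwork N
  nt = cherry⇒properNetwork net c
apply-inherits {N} net (cut a b pa pb) rc = extension-inherits nt (extendToMove nt (cut a b pa pb) rc (λ ()))
  where
  nt : ProperNetwork N
  nt = retCherry⇒properNetwork net rc

apply-network : ∀ {N} m → IsNetwork N → Applicable N m → IsNetwork (apply N m)
apply-network m net v = proj₁ (apply-inherits net m v)

relabelMove : Relabelling → Move → Move
relabelMove β (cherryMove a b p q) = cherryMove (f a) (f b) (f p) (f q) where open Relabelling β
relabelMove β (cutKeep a b pa pb ga) = cutKeep (f a) (f b) (f pa) (f pb) (f ga) where open Relabelling β
relabelMove β (cutSuppress a b pa pb ga qb) = cutSuppress (f a) (f b) (f pa) (f pb) (f ga) (f qb) where open Relabelling β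

relabelArc : Relabelling → Arc → Arc
relabelArc β (u , v) = Relabelling.f β u , Relabelling.f β v

deleted-relabel : ∀ β e → deleted (relabelMove β e) ≡ map (Relabelling.f β) (deleted e)
deleted-relabel β (cherryMove a b p q) = refl
deleted-relabel β (cutKeep a b pa pb ga) = refl
deleted-relabel β (cutSuppress a b pa pb ga qb) = refl

added-relabel : ∀ β e → added (relabelMove β e) ≡ map (relabelArc β) (added e)
added-relabel β (cherryMove a b p q) = refl
added-relabel β (cutKeep a b pa pb ga) = refl
added-relabel β (cutSuppress a b pa pb ga qb) = refl

rewire-relabel : ∀ {G H β} → G ≈[ β ] H → ∀ L X → rewire G L X ≈[ β ] rewire H (map (Relabelling.f β) L) (map (relabelArc β) X)
rewire-relabel {G} {H} {β} eq L X = rewire-cong eq (∈-map⁺ f) r← (∈-map⁺ (relabelArc β)) n←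
  where
  open Relabelling β
  r← : ∀ {y} → y ∈ map f L → g y ∈ L
  r← m with ∈-map⁻ f m
  ... | x , mx , refl = subst (_∈ L) (sym (gf x)) mx
  n← : ∀ {u v} → (u , v) ∈ map (relabelArc β) X → (g u , g v) ∈ X
  n← m with ∈-map⁻ (relabelArc β) m
  ... | (x , y) , mx , refl = subst₂' (sym (gf x)) (sym (gf y)) mx
    where subst₂' : ∀ {x' y'} → x ≡ x' → y ≡ y' → (x , y) ∈ X → (x' , y') ∈ X
          subst₂' refl refl k = k

module _ {G H : Graph} {β : Relabelling} (ntG : ProperNetwork G) (ntH : ProperNetwork H) (eq : G ≈[ β ] H) where
  open Relabelling β
  module T = Transport eq (ProperNetwork.uniqueA ntG) (ProperNetwork.uniqueA ntH)

  legal≈ : ∀ e → Legal G e → Legal H (relabelMove β e)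
  legal≈ (cherryMove a b p q) (c , mq) = T.cherry≈ c , _≈[_]_.a→ eq mq
  legal≈ (cutKeep a b pa pb ga) (rc , mga , le) = T.reticulatedCherry≈ rc , _≈[_]_.a→ eq mga , subst (3 ≤_) (sym (T.indeg≈ pb)) le
  legal≈ (cutSuppress a b pa pb ga qb) (rc , mga , i2 , mq , qn) =
    T.reticulatedCherry≈ rc , _≈[_]_.a→ eq mga , trans (T.indeg≈ pb) i2 , _≈[_]_.a→ eq mq , T.f-≢ qn

  apply≈ : ∀ e → (ev : Legal G e) → apply G (reductionOf e) ≈[ (idᴿ ∘ᴿ β) ∘ᴿ symᴿ idᴿ ] apply H (reductionOf (relabelMove β e))
  apply≈ e ev = ≈-trans (≈-trans (MoveFacts.apply≈rewire (moveFacts ntG e ev)) mid) (≈-sym (MoveFacts.apply≈rewire (moveFacts ntH (relabelMove β e) (legal≈ e ev))))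
    where
    mid : rewireBy G e ≈[ β ] rewireBy H (relabelMove β e)
    mid rewrite deleted-relabel β e | added-relabel β e = rewire-relabel eq (deleted e) (added e)

orchard≈ : ∀ {G H β} → IsNetwork G → IsNetwork H → G ≈[ β ] H → Orchard G → Orchard H
orchard≈-move : ∀ {G H β} → IsNetwork G → IsNetwork H → G ≈[ β ] H →
  ∀ m e → reductionOf e ≡ m → Legal G e → Orchard (apply G m) → Orchard H

orchard≈ nG nH eq (done G s) = done _ (singleVertex≈ eq s (network⇒wellFormed nH))
orchard≈ {G} {H} {β} nG nH eq (cherry G a b p c o) with ≡⊎≢ (indeg G p) 0
... | inj₁ p-root =
  cherry H (f a) (f b) (f p) (cherry≈ c) (subst Orchard (sym (reduceCherry-root H _ _ _ (trans (indeg≈ p) p-root))) (done _ (f a , refl , refl)))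
  where
  open Relabelling β
  open Transport eq (ProperNetwork.uniqueA (cherry⇒properNetwork nG c)) (ProperNetwork.uniqueA (properNetwork nH (_≈[_]_.a→ eq (Cherry.ma c)))) using (cherry≈; indeg≈)
... | inj₂ p-nonRoot with extendToMove (cherry⇒properNetwork nG c) (reduce a b p) c (λ { refl → p-nonRoot })
...   | e , e≡ , ev = orchard≈-move nG nH eq (reduce a b p) e e≡ ev o
orchard≈ nG nH eq (retCut G a b pa pb rc o) with extendToMove (retCherry⇒properNetwork nG rc) (cut a b pa pb) rc (λ ())
... | e , e≡ , ev = orchard≈-move nG nH eq (cut a b pa pb) e e≡ ev o

orchard≈-move {G} {H} {β} nG nH eq m e e≡ ev o =
  orchard-step (reductionOf (relabelMove β e)) (legal⇒applicable _ ev')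
    (orchard≈ (apply-network m nG (subst (Applicable G) e≡ (legal⇒applicable e ev))) (apply-network _ nH (legal⇒applicable _ ev'))
      (subst (λ m' → apply G m' ≈[ (idᴿ ∘ᴿ β) ∘ᴿ symᴿ idᴿ ] apply H (reductionOf (relabelMove β e))) e≡ (apply≈ ntG ntH eq e ev)) o)
  where
  ntG : ProperNetwork G
  ntG = legal⇒properNetwork nG e ev
  ntH : ProperNetwork H
  ntH = properNetwork nH (_≈[_]_.a→ eq (proj₂ (applicable⇒arc _ (legal⇒applicable e ev))))
  ev' : Legal H (relabelMove β e)
  ev' = legal≈ ntG ntH eq e ev

-- Commuting moves

moveVertices : Move → List ℕ
moveVertices (cherryMove a b p q) = a ∷ b ∷ p ∷ q ∷ []
moveVertices (cutKeep a b pa pb ga) = a ∷ b ∷ pa ∷ pb ∷ ga ∷ []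
moveVertices (cutSuppress a b pa pb ga qb) = a ∷ b ∷ pa ∷ pb ∷ ga ∷ qb ∷ []

ParentsSurvive : Graph → Move → List ℕ → Set
ParentsSurvive N (cherryMove a b p q) R = ⊤
ParentsSurvive N (cutKeep a b pa pb ga) R = ∀ {u} → (u , pb) ∈ arcs N → u ∉ R
ParentsSurvive N (cutSuppress a b pa pb ga qb) R = ∀ {u} → (u , pb) ∈ arcs N → u ∉ R

Disjoint : List ℕ → List ℕ → Set
Disjoint xs R = ∀ {x} → x ∈ xs → x ∉ R

legal-id : ∀ {G H} → G ≈[ idᴿ ] H → Unique (arcs G) → Unique (arcs H) → ∀ e → Legal G e → Legal H e
legal-id eq uG uH (cherryMove a b p q) (c , mq) = TT.cherry≈ c , _≈[_]_.a→ eq mq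
  where module TT = Transport eq uG uH
legal-id eq uG uH (cutKeep a b pa pb ga) (rc , mga , le) = TT.reticulatedCherry≈ rc , _≈[_]_.a→ eq mga , subst (3 ≤_) (sym (TT.indeg≈ pb)) le
  where module TT = Transport eq uG uH
legal-id eq uG uH (cutSuppress a b pa pb ga qb) (rc , mga , i2 , mq , qn) = TT.reticulatedCherry≈ rc , _≈[_]_.a→ eq mga , trans (TT.indeg≈ pb) i2 , _≈[_]_.a→ eq mq , qn
  where module TT = Transport eq uG uH

module Survivors {N : Graph} (nt : ProperNetwork N) (e1 : Move) (F : MoveFacts N e1) where
  open ProperNetwork nt
  open NetworkFacts nt
  open MoveFacts F

  private
    M : Graph
    M = rewireBy N e1
    R1 : List ℕ
    R1 = deleted e1

  survivingArc : ∀ {u v} → (u , v) ∈ arcs N → u ∉ R1 → v ∉ R1 → (u , v) ∈ arcs M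
  survivingArc m n n' = rewireA⁺ {N} {R1} {added e1} m n n'

  survivingLeaf : ∀ {x} → IsLeaf N x → x ∉ R1 → IsLeaf M x
  survivingLeaf {x} (xm , xo) xn = rewireV⁺ {N} {R1} {added e1} xm xn , ∉⇒outdeg≡0 {M} k
    where k : ∀ {u} → (x , u) ∈ arcs M → ⊥
          k m with rewireA⁻ {N} {R1} {added e1} m
          ... | inj₁ (m' , _) = outdeg≡0⇒∉ {N} xo m'
          ... | inj₂ k' = outdeg≡0⇒∉ {N} xo (proj₁ (proj₂ (added-tail k')))

  survivingIndeg : ∀ {x} → x ∉ R1 → (∀ {u} → (u , x) ∈ arcs N → u ∉ R1) → outdeg N x ≢ 0 → indeg M x ≡ indeg N x
  survivingIndeg {x} xn po nz = indeg-cong {M} {N} (proj₂ wellFormed-rewireBy) uniqueA k (λ m → survivingArc m (po m) xn)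
    where k : ∀ {u} → (u , x) ∈ arcs M → (u , x) ∈ arcs N
          k m with rewireA⁻ {N} {R1} {added e1} m
          ... | inj₁ (m' , _) = m'
          ... | inj₂ k' = ⊥-elim (nz (added-leaf k'))

  survivingReticulation : ∀ {x c} → IsReticulation N x → x ∉ R1 → (∀ {u} → (u , x) ∈ arcs N → u ∉ R1) →
    (x , c) ∈ arcs N → outdeg N c ≡ 0 → c ∉ R1 → IsReticulation M x
  survivingReticulation {x} {c} (i , o) xn po mc co cn = subst (2 ≤_) (sym (survivingIndeg xn po (λ e → 0≢1 (trans (sym e) o)))) i ,
     uniqueChild⇒outdeg≡1 {M} (proj₂ wellFormed-rewireBy) (survivingArc mc xn cn) k
    where
    uniq : ∀ {u} → (x , u) ∈ arcs N → u ≡ c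
    uniq m = outdeg≡1⇒child≡ {N} o m mc
    k : ∀ {u} → (x , u) ∈ arcs M → u ≡ c
    k m with rewireA⁻ {N} {R1} {added e1} m
    ... | inj₁ (m' , _) = uniq m'
    ... | inj₂ k' with added-tail k'
    ...   | w , mw , wo = ⊥-elim (wo (subst (λ z → outdeg N z ≡ 0) (sym (uniq mw)) co))

  survivingLegal : ∀ e2 → Legal N e2 → Disjoint (moveVertices e2) R1 → ParentsSurvive N e2 R1 → Legal M e2
  survivingLegal (cherryMove c d q q') ((c≢d , lc , ld , mc , md) , mq) D _ =
    (c≢d , survivingLeaf lc (D (here refl)) , survivingLeaf ld (D (there (here refl))) ,
     survivingArc mc (D (there (there (here refl)))) (D (here refl)) , survivingArc md (D (there (there (here refl)))) (D (there (here refl)))) ,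
    survivingArc mq (D (there (there (there (here refl))))) (D (there (there (here refl))))
  survivingLegal (cutKeep c d pc pd gc) ((c≢d , lc , ld , mc , md , rd , mcd) , mgc , le) D po =
    (c≢d , survivingLeaf lc Dc , survivingLeaf ld Dd , survivingArc mc Dpc Dc , survivingArc md Dpd Dd ,
     survivingReticulation rd Dpd po md (proj₂ ld) Dd , survivingArc mcd Dpc Dpd) ,
    survivingArc mgc (D (there (there (there (there (here refl)))))) Dpc ,
    subst (3 ≤_) (sym (survivingIndeg Dpd po (λ e → 0≢1 (trans (sym e) (proj₂ rd))))) le
    where
    Dc : c ∉ R1
    Dc = D (here refl)
    Dd : d ∉ R1
    Dd = D (there (here refl))
    Dpc : pc ∉ R1
    Dpc = D (there (there (here refl)))
    Dpd : pd ∉ R1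
    Dpd = D (there (there (there (here refl))))
  survivingLegal (cutSuppress c d pc pd gc qd) ((c≢d , lc , ld , mc , md , rd , mcd) , mgc , i2 , mqd , qn) D po =
    (c≢d , survivingLeaf lc Dc , survivingLeaf ld Dd , survivingArc mc Dpc Dc , survivingArc md Dpd Dd ,
     survivingReticulation rd Dpd po md (proj₂ ld) Dd , survivingArc mcd Dpc Dpd) ,
    survivingArc mgc (D (there (there (there (there (here refl)))))) Dpc ,
    trans (survivingIndeg Dpd po (λ e → 0≢1 (trans (sym e) (proj₂ rd)))) i2 ,
    survivingArc mqd (D (there (there (there (there (there (here refl))))))) Dpd , qn
    where
    Dc : c ∉ R1
    Dc = D (here refl)
    Dd : d ∉ R1
    Dd = D (there (here refl))
    Dpc : pc ∉ R1
    Dpc = D (there (there (here refl)))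
    Dpd : pd ∉ R1
    Dpd = D (there (there (there (here refl))))

  legal-fromRewire : ∀ e2 → Legal M e2 → Legal (apply N (reductionOf e1)) e2
  legal-fromRewire e2 = legal-id (≈-sym apply≈rewire) (proj₂ wellFormed-rewireBy) (proj₂ wellFormed-apply) e2

  legal-after : ∀ e2 → Legal N e2 → Disjoint (moveVertices e2) R1 → ParentsSurvive N e2 R1 → Legal (apply N (reductionOf e1)) e2
  legal-after e2 ev D po = legal-fromRewire e2 (survivingLegal e2 ev D po)

-- If e1 followed by e2' and e2 followed by e1' delete the same vertices and add the
-- same arcs, the two results are isomorphic rewirings of N.
closeDiamond : ∀ {N} → IsNetwork N → (e1 e2 e1' e2' : Move) → Legal N e1 → Legal N e2 →
  Legal (apply N (reductionOf e2)) e1' → Legal (apply N (reductionOf e1)) e2' →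
  (∀ {x} → x ∈ deleted e2 ++ deleted e1' → x ∈ deleted e1 ++ deleted e2') → (∀ {x} → x ∈ deleted e1 ++ deleted e2' → x ∈ deleted e2 ++ deleted e1') →
  (∀ {u v} → (u , v) ∈ surviving (deleted e1') (added e2) ++ added e1' → (u , v) ∈ surviving (deleted e2') (added e1) ++ added e2') →
  (∀ {u v} → (u , v) ∈ surviving (deleted e2') (added e1) ++ added e2' → (u , v) ∈ surviving (deleted e1') (added e2) ++ added e1') →
  OrchardAfter N (reductionOf e2) → Orchard (apply N (reductionOf e1))
closeDiamond {N} net e1 e2 e1' e2' ev1 ev2 evB evA' r→ r← n→ n← IH =
  orchard-step (reductionOf e2') vA (orchard≈ (apply-network (reductionOf e1') netB vB) (apply-network (reductionOf e2') netA vA) B≈A (IH (reductionOf e1') vB))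
  where
  A B : Graph
  A = apply N (reductionOf e1)
  B = apply N (reductionOf e2)
  ntN : ProperNetwork N
  ntN = legal⇒properNetwork net e1 ev1
  vA : Applicable A (reductionOf e2')
  vA = legal⇒applicable e2' evA'
  vB : Applicable B (reductionOf e1')
  vB = legal⇒applicable e1' evB
  netA : IsNetwork A
  netA = apply-network (reductionOf e1) net (legal⇒applicable e1 ev1)
  netB : IsNetwork B
  netB = apply-network (reductionOf e2) net (legal⇒applicable e2 ev2)
  twoSteps≈rewire : ∀ {e e'} (nt' : ProperNetwork (apply N (reductionOf e))) → Legal N e → (ev' : Legal (apply N (reductionOf e)) e') →
    apply (apply N (reductionOf e)) (reductionOf e') ≈[ idᴿ ∘ᴿ (idᴿ ∘ᴿ idᴿ) ] rewire N (deleted e ++ deleted e') (surviving (deleted e') (added e) ++ added e')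
  twoSteps≈rewire {e} {e'} nt' ev ev' =
    ≈-trans (MoveFacts.apply≈rewire (moveFacts nt' e' ev'))
      (≈-trans (rewire-cong {R = deleted e'} {R' = deleted e'} {New = added e'} {New' = added e'}
                 (MoveFacts.apply≈rewire (moveFacts ntN e ev)) (λ m → m) (λ m → m) (λ m → m) (λ m → m))
               (rewire-∘ N (deleted e) (added e) (deleted e') (added e')))
  B≈A : apply B (reductionOf e1') ≈[ (idᴿ ∘ᴿ (idᴿ ∘ᴿ idᴿ)) ∘ᴿ (idᴿ ∘ᴿ symᴿ (idᴿ ∘ᴿ (idᴿ ∘ᴿ idᴿ))) ] apply A (reductionOf e2')
  B≈A = ≈-trans (twoSteps≈rewire (applicable⇒properNetwork netB (reductionOf e1') vB) ev2 evB)
          (≈-trans (rewire-cong {G = N} {H = N} {β = idᴿ} ≈-refl r→ r← n→ n←)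
                   (≈-sym (twoSteps≈rewire (applicable⇒properNetwork netA (reductionOf e2') vA) ev1 evA')))

AddedSurvive : Move → List ℕ → Set
AddedSurvive e R = ∀ {u v} → (u , v) ∈ added e → (u ∉ R) × (v ∉ R)

addedSurvive : ∀ e {R} → Disjoint (moveVertices e) R → AddedSurvive e R
addedSurvive (cherryMove a b p q) D (here refl) = D (there (there (there (here refl)))) , D (here refl)
addedSurvive (cutKeep a b pa pb ga) D (here refl) = D (there (there (there (there (here refl))))) , D (here refl)
addedSurvive (cutSuppress a b pa pb ga qb) D (here refl) = D (there (there (there (there (here refl))))) , D (here refl)
addedSurvive (cutSuppress a b pa pb ga qb) D (there (here refl)) = D (there (there (there (there (there (here refl)))))) , D (there (here refl))

∈-++-swap : ∀ {R1 R2 : List ℕ} {x} → x ∈ R2 ++ R1 → x ∈ R1 ++ R2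
∈-++-swap {R1} {R2} m with ∈-++⁻ R2 m
... | inj₁ k = ∈-++⁺ʳ R1 k
... | inj₂ k = ∈-++⁺ˡ k

added-swap : ∀ {e1 e2} → AddedSurvive e1 (deleted e2) →
  ∀ {u v} → (u , v) ∈ surviving (deleted e1) (added e2) ++ added e1 → (u , v) ∈ surviving (deleted e2) (added e1) ++ added e2
added-swap {e1} {e2} ok m with ∈-++⁻ (surviving (deleted e1) (added e2)) m
... | inj₁ k = ∈-++⁺ʳ (surviving (deleted e2) (added e1)) (proj₁ (∈-filter⁻ (keepArc? (deleted e1)) {xs = added e2} k))
... | inj₂ k = ∈-++⁺ˡ (∈-filter⁺ (keepArc? (deleted e2)) k (ok k))

commute : ∀ {N} → IsNetwork N → ∀ e1 e2 → (ev1 : Legal N e1) → (ev2 : Legal N e2) →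
  Disjoint (moveVertices e1) (deleted e2) → ParentsSurvive N e1 (deleted e2) → Disjoint (moveVertices e2) (deleted e1) → ParentsSurvive N e2 (deleted e1) →
  OrchardAfter N (reductionOf e2) → Orchard (apply N (reductionOf e1))
commute {N} net e1 e2 ev1 ev2 D12 P12' D21 P21 o =
  closeDiamond net e1 e2 e1 e2 ev1 ev2
    (Survivors.legal-after nt e2 (moveFacts nt e2 ev2) e1 ev1 D12 P12')
    (Survivors.legal-after nt e1 (moveFacts nt e1 ev1) e2 ev2 D21 P21)
    (∈-++-swap {deleted e1} {deleted e2}) (∈-++-swap {deleted e2} {deleted e1})
    (added-swap {e1} {e2} (addedSurvive e1 D12)) (added-swap {e2} {e1} (addedSurvive e2 D21)) o
  where
  nt : ProperNetwork N
  nt = legal⇒properNetwork net e1 ev1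

module LocalFacts {N : Graph} (nt : ProperNetwork N) where
  open ProperNetwork nt
  open NetworkFacts nt

  cherry-children : ∀ {a b p} → IsCherry N a b p → ∀ {u} → (p , u) ∈ arcs N → u ≡ a ⊎ u ≡ b
  cherry-children (a≢b , _ , _ , ma , mb) = outdeg≡2⇒children {N} (twoChildren⇒outdeg≡2 ma mb a≢b) ma mb a≢b

  treeParent-children : ∀ {a b pa pb} → IsReticulatedCherry N a b pa pb → ∀ {u} → (pa , u) ∈ arcs N → u ≡ a ⊎ u ≡ pb
  treeParent-children (_ , (_ , ao) , _ , ma , _ , (_ , ro) , mab) = outdeg≡2⇒children {N} (twoChildren⇒outdeg≡2 ma mab a≢pb) ma mab a≢pb
    where a≢pb : _
          a≢pb refl = 0≢1 (trans (sym ao) ro)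

  retParent-child : ∀ {a b pa pb} → IsReticulatedCherry N a b pa pb → ∀ {u} → (pb , u) ∈ arcs N → u ≡ b
  retParent-child (_ , _ , _ , _ , mb , (_ , ro) , _) m = outdeg≡1⇒child≡ {N} ro m mb

  leaf-noArc : ∀ {x u} → IsLeaf N x → (x , u) ∈ arcs N → ⊥
  leaf-noArc (_ , o) m = outdeg≡0⇒∉ {N} o m

  disjoint-cherries : ∀ {a b p q c d p' q'} → Legal N (cherryMove a b p q) → Legal N (cherryMove c d p' q') → p ≢ p' →
    Disjoint (moveVertices (cherryMove a b p q)) (deleted (cherryMove c d p' q'))
  disjoint-cherries {a} {b} {p} {q} {c} {d} {p'} {q'} (ch1@(_ , la , lb , ma , mb) , mq) (ch2@(_ , lc , ld , mc , md) , mq') n = D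
    where
    D : Disjoint (moveVertices (cherryMove a b p q)) (deleted (cherryMove c d p' q'))
    D (here refl) (here refl) = n (sym (leaf-uniqueParent la ma md))
    D (here refl) (there (here refl)) = leaf-noArc la mc
    D (there (here refl)) (here refl) = n (sym (leaf-uniqueParent lb mb md))
    D (there (here refl)) (there (here refl)) = leaf-noArc lb mc
    D (there (there (here refl))) (here refl) = leaf-noArc ld ma
    D (there (there (here e))) (there (here e')) = n (trans (sym e) e')
    D (there (there (there (here refl)))) (here refl) = leaf-noArc ld mq
    D (there (there (there (here e)))) (there (here e')) with cherry-children ch2 (subst (λ z → (z , p) ∈ arcs N) (trans (sym e) e') mq)
    ... | inj₁ e = leaf-noArc lc (subst (λ z → (z , a) ∈ arcs N) e ma)
    ... | inj₂ e = leaf-noArc ld (subst (λ z → (z , a) ∈ arcs N) e ma)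

module Roles {N : Graph} (nt : ProperNetwork N) where
  open ProperNetwork nt
  open NetworkFacts nt
  open LocalFacts nt

  data CherryRole (a b p x : ℕ) : Set where
    rA : x ≡ a → CherryRole a b p x
    rB : x ≡ b → CherryRole a b p x
    rP : x ≡ p → CherryRole a b p x
    rQ : (x , p) ∈ arcs N → CherryRole a b p x

  data CutRole (a b pa pb x : ℕ) : Set where
    sA : x ≡ a → CutRole a b pa pb x
    sB : x ≡ b → CutRole a b pa pb x
    sPa : x ≡ pa → CutRole a b pa pb x
    sPb : x ≡ pb → CutRole a b pa pb x
    sGa : (x , pa) ∈ arcs N → CutRole a b pa pb x
    sQb : (x , pb) ∈ arcs N → CutRole a b pa pb x

  ∈-pair : ∀ {x y z : ℕ} → x ∈ y ∷ z ∷ [] → x ≡ y ⊎ x ≡ z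
  ∈-pair (here e) = inj₁ e
  ∈-pair (there (here e)) = inj₂ e

  module CherryVsCut {a b p c d pc pd : ℕ} (ch : IsCherry N a b p) (rc : IsReticulatedCherry N c d pc pd) where
    open Cherry ch using (la; lb; ma; mb; a≢b)
    open RetCherry rc using () renaming (la to lc; lb to ld; ma to mc; mb to md; mab to mcd)
    pd-notch : ∀ {u} → (p , u) ∈ arcs N → u ≢ pd
    pd-notch m e with cherry-children ch m
    ... | inj₁ e' = leaf-noArc la (subst (λ z → (z , d) ∈ arcs N) (trans (sym e) e') md)
    ... | inj₂ e' = leaf-noArc lb (subst (λ z → (z , d) ∈ arcs N) (trans (sym e) e') md)
    p≢pc : p ≢ pc
    p≢pc e = pd-notch (subst (λ z → (z , pd) ∈ arcs N) (sym e) mcd) refl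
    p≢pd : p ≢ pd
    p≢pd e = a≢b (trans (retParent-child rc (subst (λ z → (z , a) ∈ arcs N) e ma)) (sym (retParent-child rc (subst (λ z → (z , b) ∈ arcs N) e mb))))
    cherryRoles∉cut : ∀ {x} → CherryRole a b p x → x ∉ pc ∷ pd ∷ []
    cherryRoles∉cut (rA refl) m with ∈-pair m
    ... | inj₁ refl = leaf-noArc la mc
    ... | inj₂ refl = leaf-noArc la md
    cherryRoles∉cut (rB refl) m with ∈-pair m
    ... | inj₁ refl = leaf-noArc lb mc
    ... | inj₂ refl = leaf-noArc lb md
    cherryRoles∉cut (rP refl) m with ∈-pair m
    ... | inj₁ e = p≢pc e
    ... | inj₂ e = p≢pd e
    cherryRoles∉cut (rQ mq) m with ∈-pair m
    ... | inj₁ refl with treeParent-children rc mq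
    ...   | inj₁ refl = leaf-noArc lc ma
    ...   | inj₂ e = p≢pd e
    cherryRoles∉cut (rQ mq) m | inj₂ refl = leaf-noArc ld (subst (λ z → (z , a) ∈ arcs N) (retParent-child rc mq) ma)
    cutRoles∉cherry : ∀ {x} → CutRole c d pc pd x → x ∉ b ∷ p ∷ []
    cutRoles∉cherry (sA refl) m with ∈-pair m
    ... | inj₁ refl = p≢pc (sym (leaf-uniqueParent lb mb mc))
    ... | inj₂ refl = leaf-noArc lc ma
    cutRoles∉cherry (sB refl) m with ∈-pair m
    ... | inj₁ refl = p≢pd (sym (leaf-uniqueParent lb mb md))
    ... | inj₂ refl = leaf-noArc ld ma
    cutRoles∉cherry (sPa refl) m with ∈-pair m
    ... | inj₁ refl = leaf-noArc lb mc
    ... | inj₂ e = p≢pc (sym e)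
    cutRoles∉cherry (sPb refl) m with ∈-pair m
    ... | inj₁ refl = leaf-noArc lb md
    ... | inj₂ e = p≢pd (sym e)
    cutRoles∉cherry (sGa mg) m with ∈-pair m
    ... | inj₁ refl = leaf-noArc lb mg
    ... | inj₂ refl with cherry-children ch mg
    ...   | inj₁ refl = leaf-noArc la mc
    ...   | inj₂ refl = leaf-noArc lb mc
    cutRoles∉cherry (sQb mq) m with ∈-pair m
    ... | inj₁ refl = leaf-noArc lb mq
    ... | inj₂ refl = pd-notch mq refl

  module CutVsCut {a b pa pb c d pc pd : ℕ} (r1 : IsReticulatedCherry N a b pa pb) (rc : IsReticulatedCherry N c d pc pd) (b≢d : b ≢ d) where
    open RetCherry r1 using (la; lb; ma; mb; mab)
    open RetCherry rc using () renaming (la to lc; lb to ld; ma to mc; mb to md; mab to mcd)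
    pb≢pd : pb ≢ pd
    pb≢pd e = b≢d (retParent-child rc (subst (λ z → (z , b) ∈ arcs N) e mb))
    pb≢pc : pb ≢ pc
    pb≢pc e = leaf-noArc lb (subst (λ z → (z , d) ∈ arcs N) (retParent-child r1 (subst (λ z → (z , pd) ∈ arcs N) (sym e) mcd)) md)
    pa≢pd : pa ≢ pd
    pa≢pd e = leaf-noArc la (subst (λ z → (z , b) ∈ arcs N) pb≡a mb)
      where
      pb≡a : pb ≡ a
      pb≡a = trans (retParent-child rc (subst (λ z → (z , pb) ∈ arcs N) e mab)) (sym (retParent-child rc (subst (λ z → (z , a) ∈ arcs N) e ma)))
    pcpar : ∀ {x y} → (pc , y) ∈ arcs N → (x , y) ∈ arcs N → y ≡ pa ⊎ y ≡ pb → ⊥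
    pcpar {x} {y} m _ w with treeParent-children rc m | w
    ... | inj₁ refl | inj₁ refl = leaf-noArc lc ma
    ... | inj₁ refl | inj₂ refl = leaf-noArc lc mb
    ... | inj₂ refl | inj₁ refl = pa≢pd refl
    ... | inj₂ refl | inj₂ refl = pb≢pd refl
    pdpar : ∀ {y} → (pd , y) ∈ arcs N → y ≡ pa ⊎ y ≡ pb → ⊥
    pdpar m (inj₁ refl) with retParent-child rc m
    ... | refl = leaf-noArc ld ma
    pdpar m (inj₂ refl) with retParent-child rc m
    ... | refl = leaf-noArc ld mb
    pa≢pc : pa ≢ pc
    pa≢pc e = pcpar (subst (λ z → (z , pb) ∈ arcs N) e mab) mab (inj₂ refl)
    cutRoles∉cut : ∀ {x} → CutRole a b pa pb x → x ∉ pc ∷ pd ∷ []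
    cutRoles∉cut (sA refl) m with ∈-pair m
    ... | inj₁ refl = leaf-noArc la mc
    ... | inj₂ refl = leaf-noArc la md
    cutRoles∉cut (sB refl) m with ∈-pair m
    ... | inj₁ refl = leaf-noArc lb mc
    ... | inj₂ refl = leaf-noArc lb md
    cutRoles∉cut (sPa refl) m with ∈-pair m
    ... | inj₁ e = pa≢pc e
    ... | inj₂ e = pa≢pd e
    cutRoles∉cut (sPb refl) m with ∈-pair m
    ... | inj₁ e = pb≢pc e
    ... | inj₂ e = pb≢pd e
    cutRoles∉cut (sGa mg) m with ∈-pair m
    ... | inj₁ refl = pcpar mg mg (inj₁ refl)
    ... | inj₂ refl = pdpar mg (inj₁ refl)
    cutRoles∉cut (sQb mq) m with ∈-pair m
    ... | inj₁ refl = pcpar mq mq (inj₂ refl)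
    ... | inj₂ refl = pdpar mq (inj₂ refl)

-- A cherry parent is never part of a reticulated cherry, so only two cherries with the
-- same parent, or two reticulated cherries with the same reticulation leaf, interfere.
Independent : Move → Move → Set
Independent (cherryMove _ _ p _) (cherryMove _ _ p' _) = p ≢ p'
Independent (cherryMove _ _ _ _) (cutKeep _ _ _ _ _) = ⊤
Independent (cherryMove _ _ _ _) (cutSuppress _ _ _ _ _ _) = ⊤
Independent (cutKeep _ _ _ _ _) (cherryMove _ _ _ _) = ⊤
Independent (cutSuppress _ _ _ _ _ _) (cherryMove _ _ _ _) = ⊤
Independent (cutKeep _ b _ _ _) (cutKeep _ d _ _ _) = b ≢ d
Independent (cutKeep _ b _ _ _) (cutSuppress _ d _ _ _ _) = b ≢ d
Independent (cutSuppress _ b _ _ _ _) (cutKeep _ d _ _ _) = b ≢ d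
Independent (cutSuppress _ b _ _ _ _) (cutSuppress _ d _ _ _ _) = b ≢ d

module Independence {N : Graph} (nt : ProperNetwork N) where
  open ProperNetwork nt
  open NetworkFacts nt
  open LocalFacts nt
  open Roles nt

  cherryRole : ∀ {a b p q x} → Legal N (cherryMove a b p q) → x ∈ moveVertices (cherryMove a b p q) → CherryRole a b p x
  cherryRole _ (here e) = rA e
  cherryRole _ (there (here e)) = rB e
  cherryRole _ (there (there (here e))) = rP e
  cherryRole (_ , mq) (there (there (there (here refl)))) = rQ mq

  cutKeepRole : ∀ {a b pa pb ga x} → Legal N (cutKeep a b pa pb ga) → x ∈ moveVertices (cutKeep a b pa pb ga) → CutRole a b pa pb x
  cutKeepRole _ (here e) = sA e
  cutKeepRole _ (there (here e)) = sB e
  cutKeepRole _ (there (there (here e))) = sPa e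
  cutKeepRole _ (there (there (there (here e)))) = sPb e
  cutKeepRole (_ , mg , _) (there (there (there (there (here refl))))) = sGa mg

  cutSuppressRole : ∀ {a b pa pb ga qb x} → Legal N (cutSuppress a b pa pb ga qb) → x ∈ moveVertices (cutSuppress a b pa pb ga qb) → CutRole a b pa pb x
  cutSuppressRole _ (here e) = sA e
  cutSuppressRole _ (there (here e)) = sB e
  cutSuppressRole _ (there (there (here e))) = sPa e
  cutSuppressRole _ (there (there (there (here e)))) = sPb e
  cutSuppressRole (_ , mg , _) (there (there (there (there (here refl))))) = sGa mg
  cutSuppressRole (_ , _ , _ , mq , _) (there (there (there (there (there (here refl)))))) = sQb mq

  ∈-[x]⇒∈-pair : ∀ {x pc pd : ℕ} → x ∈ pc ∷ [] → x ∈ pc ∷ pd ∷ []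
  ∈-[x]⇒∈-pair (here e) = here e

  independent⇒disjoint : ∀ e1 e2 → Legal N e1 → Legal N e2 → Independent e1 e2 → Disjoint (moveVertices e1) (deleted e2) × ParentsSurvive N e1 (deleted e2)
  independent⇒disjoint (cherryMove a b p q) (cherryMove c d p' q') ev1 ev2 n = disjoint-cherries ev1 ev2 n , tt
  independent⇒disjoint (cherryMove a b p q) (cutKeep c d pc pd gc) ev1 ev2 _ =
    (λ m m' → CherryVsCut.cherryRoles∉cut (proj₁ ev1) (proj₁ ev2) (cherryRole ev1 m) (∈-[x]⇒∈-pair m')) , tt
  independent⇒disjoint (cherryMove a b p q) (cutSuppress c d pc pd gc qd) ev1 ev2 _ =
    (λ m m' → CherryVsCut.cherryRoles∉cut (proj₁ ev1) (proj₁ ev2) (cherryRole ev1 m) m') , tt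
  independent⇒disjoint (cutKeep a b pa pb ga) (cherryMove c d p q) ev1 ev2 _ =
    (λ m m' → CherryVsCut.cutRoles∉cherry (proj₁ ev2) (proj₁ ev1) (cutKeepRole ev1 m) m') , (λ mu m' → CherryVsCut.cutRoles∉cherry (proj₁ ev2) (proj₁ ev1) (sQb mu) m')
  independent⇒disjoint (cutSuppress a b pa pb ga qb) (cherryMove c d p q) ev1 ev2 _ =
    (λ m m' → CherryVsCut.cutRoles∉cherry (proj₁ ev2) (proj₁ ev1) (cutSuppressRole ev1 m) m') , (λ mu m' → CherryVsCut.cutRoles∉cherry (proj₁ ev2) (proj₁ ev1) (sQb mu) m')
  independent⇒disjoint (cutKeep a b pa pb ga) (cutKeep c d pc pd gc) ev1 ev2 n =
    (λ m m' → CutVsCut.cutRoles∉cut (proj₁ ev1) (proj₁ ev2) n (cutKeepRole ev1 m) (∈-[x]⇒∈-pair m')) ,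
    (λ mu m' → CutVsCut.cutRoles∉cut (proj₁ ev1) (proj₁ ev2) n (sQb mu) (∈-[x]⇒∈-pair m'))
  independent⇒disjoint (cutKeep a b pa pb ga) (cutSuppress c d pc pd gc qd) ev1 ev2 n =
    (λ m m' → CutVsCut.cutRoles∉cut (proj₁ ev1) (proj₁ ev2) n (cutKeepRole ev1 m) m') , (λ mu m' → CutVsCut.cutRoles∉cut (proj₁ ev1) (proj₁ ev2) n (sQb mu) m')
  independent⇒disjoint (cutSuppress a b pa pb ga qb) (cutKeep c d pc pd gc) ev1 ev2 n =
    (λ m m' → CutVsCut.cutRoles∉cut (proj₁ ev1) (proj₁ ev2) n (cutSuppressRole ev1 m) (∈-[x]⇒∈-pair m')) ,
    (λ mu m' → CutVsCut.cutRoles∉cut (proj₁ ev1) (proj₁ ev2) n (sQb mu) (∈-[x]⇒∈-pair m'))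
  independent⇒disjoint (cutSuppress a b pa pb ga qb) (cutSuppress c d pc pd gc qd) ev1 ev2 n =
    (λ m m' → CutVsCut.cutRoles∉cut (proj₁ ev1) (proj₁ ev2) n (cutSuppressRole ev1 m) m') , (λ mu m' → CutVsCut.cutRoles∉cut (proj₁ ev1) (proj₁ ev2) n (sQb mu) m')

commute-independent : ∀ {N} → IsNetwork N → ∀ e1 e2 → (ev1 : Legal N e1) → (ev2 : Legal N e2) → Independent e1 e2 → Independent e2 e1 →
  OrchardAfter N (reductionOf e2) → Orchard (apply N (reductionOf e1))
commute-independent {N} net e1 e2 ev1 ev2 n12 n21 o
  with independent⇒disjoint e1 e2 ev1 ev2 n12 | independent⇒disjoint e2 e1 ev2 ev1 n21
  where
  nt : ProperNetwork N
  nt = legal⇒properNetwork net e1 ev1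
  open Independence nt using (independent⇒disjoint)
... | D12 , P12 | D21 , P21 = commute net e1 e2 ev1 ev2 D12 P12 D21 P21 o

surviving-++-elim : ∀ {R : List ℕ} {X Y L : List Arc} → (∀ {u v} → (u , v) ∈ X → u ∉ R → v ∉ R → (u , v) ∈ L) →
  (∀ {u v} → (u , v) ∈ Y → (u , v) ∈ L) → ∀ {u v} → (u , v) ∈ surviving R X ++ Y → (u , v) ∈ L
surviving-++-elim {R} {X} {Y} f g m with ∈-++⁻ (surviving R X) m
... | inj₂ k = g k
... | inj₁ k with ∈-filter⁻ (keepArc? R) {xs = X} k
... | k' , n , n' = f k' n n'

∈-surviving-++ˡ : ∀ {R : List ℕ} {X Y : List Arc} {u v} → (u , v) ∈ X → u ∉ R → v ∉ R → (u , v) ∈ surviving R X ++ Y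
∈-surviving-++ˡ {R} m n n' = ∈-++⁺ˡ (∈-filter⁺ (keepArc? R) m (n , n'))

∈-surviving-++ʳ : ∀ {R : List ℕ} {X Y : List Arc} {u v} → (u , v) ∈ Y → (u , v) ∈ surviving R X ++ Y
∈-surviving-++ʳ {R} {X} m = ∈-++⁺ʳ (surviving R X) m

module CherrySwap {N : Graph} (nt : ProperNetwork N) {a b p : ℕ} (ch : IsCherry N a b p) where
  open NetworkFacts nt
  open Cherry ch

  tail-fixed : ∀ {u v} → (u , v) ∈ arcs N → swap a b u ≡ u
  tail-fixed m = swap-≢ (≢-sym (leaf≢tail ao m)) (≢-sym (leaf≢tail bo m))

  vmap : ∀ {x} → x ∈ vertices N → swap a b x ∈ vertices N
  vmap {x} m with ≡⊎≢ x a | ≡⊎≢ x b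
  ... | inj₁ refl | _ = subst (_∈ vertices N) (sym (swap-ˡ x b)) bm
  ... | inj₂ _ | inj₁ refl = subst (_∈ vertices N) (sym (swap-ʳ a x a≢b)) am
  ... | inj₂ xa | inj₂ xb = subst (_∈ vertices N) (sym (swap-≢ xa xb)) m

  amap : ∀ {u v} → (u , v) ∈ arcs N → (swap a b u , swap a b v) ∈ arcs N
  amap {u} {v} m with ≡⊎≢ v a | ≡⊎≢ v b
  ... | inj₁ refl | _ with leaf-uniqueParent la ma m
  ...   | refl = subst₂ (λ x y → (x , y) ∈ arcs N) (sym (tail-fixed m)) (sym (swap-ˡ v b)) mb
  amap {u} {v} m | inj₂ _ | inj₁ refl with leaf-uniqueParent lb mb m
  ...   | refl = subst₂ (λ x y → (x , y) ∈ arcs N) (sym (tail-fixed m)) (sym (swap-ʳ a v a≢b)) ma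
  amap {u} {v} m | inj₂ va | inj₂ vb = subst₂ (λ x y → (x , y) ∈ arcs N) (sym (tail-fixed m)) (sym (swap-≢ va vb)) m

  swap≈ : N ≈[ swapRelabelling a b a≢b ] N
  swap≈ = iso vmap vmap amap amap

rootCherry⇒onlyRootHasChildren : ∀ {N} → (nt : ProperNetwork N) → ∀ {c d q} → IsCherry N c d q → indeg N q ≡ 0 → ∀ {x y} → (x , y) ∈ arcs N → x ≡ q
rootCherry⇒onlyRootHasChildren {N} nt {c} {d} {q} ch i0 {x} m
  with NetworkFacts.reachableFromRoot nt x (NetworkFacts.tailV nt m) | ProperNetwork.root-unique nt q (NetworkFacts.tailV nt (Cherry.ma ch)) i0
... | inj₁ e | e' = trans e (sym e')
... | inj₂ pth | refl = ⊥-elim (k pth)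
  where
  open LocalFacts nt
  k : Path⁺ N (ProperNetwork.root nt) x → ⊥
  k (edge m') with cherry-children ch m'
  ... | inj₁ refl = leaf-noArc (Cherry.la ch) m
  ... | inj₂ refl = leaf-noArc (Cherry.lb ch) m
  k (step m' pth') with cherry-children ch m'
  ... | inj₁ refl = outdeg≡0⇒noPath (Cherry.ao ch) pth'
  ... | inj₂ refl = outdeg≡0⇒noPath (Cherry.bo ch) pth'

-- Overlapping moves

module DegreeDrop {N : Graph} (nt : ProperNetwork N) (e : Move) (F : MoveFacts N e) where
  open ProperNetwork nt
  open NetworkFacts nt
  open MoveFacts F
  private
    M : Graph
    M = rewireBy N e
    R : List ℕ
    R = deleted e

  indeg-drop : ∀ {x w} → outdeg N x ≢ 0 → x ∉ R → w ∈ R → (w , x) ∈ arcs N → (∀ {u} → (u , x) ∈ arcs N → u ∈ R → u ≡ w) →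
    indeg N x ≡ suc (indeg M x)
  indeg-drop {x} {w} nz xn wR mw uq = indeg≡suc {N} {M} {x} {x} {w} uniqueA (proj₂ wellFormed-rewireBy) f g mw k
    where
    f : ∀ {u} → (u , x) ∈ arcs N → (u , x) ∈ arcs M ⊎ u ≡ w
    f {u} m with u ∈? R
    ... | yes uR = inj₂ (uq m uR)
    ... | no un = inj₁ (rewireA⁺ {N} {R} {added e} m un xn)
    g : ∀ {u} → (u , x) ∈ arcs M → (u , x) ∈ arcs N
    g m with rewireA⁻ {N} {R} {added e} m
    ... | inj₁ (m' , _) = m'
    ... | inj₂ k' = ⊥-elim (nz (added-leaf k'))
    k : (w , x) ∉ arcs M
    k m with rewireA⁻ {N} {R} {added e} m
    ... | inj₁ (_ , n , _) = n wR
    ... | inj₂ k' = nz (added-leaf k')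

  outdeg≡1-survives : ∀ {x c} → outdeg N x ≡ 1 → (x , c) ∈ arcs N → outdeg N c ≡ 0 → c ∉ R → x ∉ R → outdeg M x ≡ 1
  outdeg≡1-survives {x} {c} o mc co cn xn = uniqueChild⇒outdeg≡1 {M} (proj₂ wellFormed-rewireBy) (rewireA⁺ {N} {R} {added e} mc xn cn) k
    where
    uniq : ∀ {u} → (x , u) ∈ arcs N → u ≡ c
    uniq m = outdeg≡1⇒child≡ {N} o m mc
    k : ∀ {u} → (x , u) ∈ arcs M → u ≡ c
    k m with rewireA⁻ {N} {R} {added e} m
    ... | inj₁ (m' , _) = uniq m'
    ... | inj₂ k' with added-tail k'
    ...   | w , mw , wo = ⊥-elim (wo (subst (λ z → outdeg N z ≡ 0) (sym (uniq mw)) co))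

module SharedLeaf {N : Graph} (nt : ProperNetwork N) {a b pa pb c pc ga : ℕ}
  (r1 : IsReticulatedCherry N a b pa pb) (r2 : IsReticulatedCherry N c b pc pb) (mga : (ga , pa) ∈ arcs N) (a≢c : a ≢ c) where
  open ProperNetwork nt
  open NetworkFacts nt
  open LocalFacts nt
  open RetCherry r1 public using (a≢b; la; lb; ma; mb; mab)
  open RetCherry r2 public using () renaming (la to lc; ma to mc)
  pa≢pc : pa ≢ pc
  pa≢pc e with treeParent-children r2 (subst (λ z → (z , a) ∈ arcs N) e ma)
  ... | inj₁ e' = a≢c e'
  ... | inj₂ refl = leaf-noArc la mb
  a≢pc : a ≢ pc
  a≢pc refl = leaf-noArc la mc
  a≢pb : a ≢ pb
  a≢pb refl = leaf-noArc la mb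
  b≢pc : b ≢ pc
  b≢pc refl = leaf-noArc lb mc
  b≢pb : b ≢ pb
  b≢pb refl = leaf-noArc lb mb
  pa≢pb : pa ≢ pb
  pa≢pb refl = noLoop mab
  ga≢pc : ga ≢ pc
  ga≢pc e with treeParent-children r2 (subst (λ z → (z , pa) ∈ arcs N) e mga)
  ... | inj₁ refl = leaf-noArc lc ma
  ... | inj₂ refl = noLoop mab
  ga≢pb : ga ≢ pb
  ga≢pb e with retParent-child r1 (subst (λ z → (z , pa) ∈ arcs N) e mga)
  ... | refl = leaf-noArc lb ma
  ga≢b : ga ≢ b
  ga≢b refl = leaf-noArc lb mga

-- Cutting {a , b} suppresses pb and turns {c , b} into a cherry with parent pc, and
-- symmetrically; reducing b from it then deletes pa, pb, pc and b on both sides.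
sharedLeaf-indeg2 : ∀ {N a b pa pb ga qb c pc gc qd} → IsNetwork N → (ev1 : Legal N (cutSuppress a b pa pb ga qb)) → (ev2 : Legal N (cutSuppress c b pc pb gc qd)) →
  a ≢ c → OrchardAfter N (cut c b pc pb) → Orchard (apply N (cut a b pa pb))
sharedLeaf-indeg2 {N} {a} {b} {pa} {pb} {ga} {qb} {c} {pc} {gc} {qd} net ev1@(r1 , mga , i2 , mqb , qbn) ev2@(r2 , mgc , _ , mqd , qdn) a≢c o =
  closeDiamond net (cutSuppress a b pa pb ga qb) (cutSuppress c b pc pb gc qd) (cherryMove a b pa ga) (cherryMove c b pc gc) ev1 ev2 evB evA r→ r← n→ n← o
  where
  nt : ProperNetwork N
  nt = retCherry⇒properNetwork net r1
  FP : MoveFacts N (cutSuppress a b pa pb ga qb)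
  FP = moveFacts nt (cutSuppress a b pa pb ga qb) ev1
  FQ : MoveFacts N (cutSuppress c b pc pb gc qd)
  FQ = moveFacts nt (cutSuppress c b pc pb gc qd) ev2
  module TP = Survivors nt (cutSuppress a b pa pb ga qb) FP
  module TQ = Survivors nt (cutSuppress c b pc pb gc qd) FQ
  module S1 = SharedLeaf nt r1 r2 mga a≢c
  module S2 = SharedLeaf nt r2 r1 mgc (λ e → a≢c (sym e))
  pbpar : ∀ {u} → (u , pb) ∈ arcs N → u ≡ pa ⊎ u ≡ pc
  pbpar = indeg≡2⇒parents {N} i2 S1.mab S2.mab S1.pa≢pc
  qd≡pa : qd ≡ pa
  qd≡pa with pbpar mqd
  ... | inj₁ e = e
  ... | inj₂ e = ⊥-elim (qdn e)
  qb≡pc : qb ≡ pc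
  qb≡pc with pbpar mqb
  ... | inj₁ e = ⊥-elim (qbn e)
  ... | inj₂ e = e
  evB : Legal (apply N (cut c b pc pb)) (cherryMove a b pa ga)
  evB = TQ.legal-fromRewire (cherryMove a b pa ga)
    ((S1.a≢b , TQ.survivingLeaf S1.la (∉₂ S1.a≢pc S1.a≢pb) , TQ.survivingLeaf S1.lb (∉₂ S1.b≢pc S1.b≢pb) ,
      TQ.survivingArc S1.ma (∉₂ S1.pa≢pc S1.pa≢pb) (∉₂ S1.a≢pc S1.a≢pb) ,
      subst (λ z → (z , b) ∈ arcs (rewireBy N (cutSuppress c b pc pb gc qd))) qd≡pa (rewireNew⁺ {N} {pc ∷ pb ∷ []} (there (here refl)))) ,
     TQ.survivingArc mga (∉₂ S1.ga≢pc S1.ga≢pb) (∉₂ S1.pa≢pc S1.pa≢pb))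
  evA : Legal (apply N (cut a b pa pb)) (cherryMove c b pc gc)
  evA = TP.legal-fromRewire (cherryMove c b pc gc)
    ((S2.a≢b , TP.survivingLeaf S2.la (∉₂ S2.a≢pc S2.a≢pb) , TP.survivingLeaf S2.lb (∉₂ S2.b≢pc S2.b≢pb) ,
      TP.survivingArc S2.ma (∉₂ S2.pa≢pc S2.pa≢pb) (∉₂ S2.a≢pc S2.a≢pb) ,
      subst (λ z → (z , b) ∈ arcs (rewireBy N (cutSuppress a b pa pb ga qb))) qb≡pc (rewireNew⁺ {N} {pa ∷ pb ∷ []} (there (here refl)))) ,
     TP.survivingArc mgc (∉₂ S2.ga≢pc S2.ga≢pb) (∉₂ S2.pa≢pc S2.pa≢pb))
  r→ : ∀ {x} → x ∈ (pc ∷ pb ∷ []) ++ (b ∷ pa ∷ []) → x ∈ (pa ∷ pb ∷ []) ++ (b ∷ pc ∷ [])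
  r→ = all∈⇒⊆ (there (there (there (here refl))) ∷ there (here refl) ∷ there (there (here refl)) ∷ here refl ∷ [])
  r← : ∀ {x} → x ∈ (pa ∷ pb ∷ []) ++ (b ∷ pc ∷ []) → x ∈ (pc ∷ pb ∷ []) ++ (b ∷ pa ∷ [])
  r← = all∈⇒⊆ (there (there (there (here refl))) ∷ there (here refl) ∷ there (there (here refl)) ∷ here refl ∷ [])
  n→ : ∀ {u v} → (u , v) ∈ surviving (b ∷ pa ∷ []) ((gc , c) ∷ (qd , b) ∷ []) ++ (ga , a) ∷ [] →
                 (u , v) ∈ surviving (b ∷ pc ∷ []) ((ga , a) ∷ (qb , b) ∷ []) ++ (gc , c) ∷ []
  n→ = surviving-++-elim {R = b ∷ pa ∷ []} {X = (gc , c) ∷ (qd , b) ∷ []} f g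
    where
    f : ∀ {u v} → (u , v) ∈ (gc , c) ∷ (qd , b) ∷ [] → u ∉ b ∷ pa ∷ [] → v ∉ b ∷ pa ∷ [] → _
    f (here refl) _ _ = ∈-surviving-++ʳ {R = b ∷ pc ∷ []} {X = (ga , a) ∷ (qb , b) ∷ []} (here refl)
    f (there (here refl)) n _ = ⊥-elim (n (there (here qd≡pa)))
    g : ∀ {u v} → (u , v) ∈ (ga , a) ∷ [] → _
    g (here refl) = ∈-surviving-++ˡ {R = b ∷ pc ∷ []} (here refl) (∉₂ S1.ga≢b S1.ga≢pc) (∉₂ S1.a≢b S1.a≢pc)
  n← : ∀ {u v} → (u , v) ∈ surviving (b ∷ pc ∷ []) ((ga , a) ∷ (qb , b) ∷ []) ++ (gc , c) ∷ [] →
                 (u , v) ∈ surviving (b ∷ pa ∷ []) ((gc , c) ∷ (qd , b) ∷ []) ++ (ga , a) ∷ []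
  n← = surviving-++-elim {R = b ∷ pc ∷ []} {X = (ga , a) ∷ (qb , b) ∷ []} f g
    where
    f : ∀ {u v} → (u , v) ∈ (ga , a) ∷ (qb , b) ∷ [] → u ∉ b ∷ pc ∷ [] → v ∉ b ∷ pc ∷ [] → _
    f (here refl) _ _ = ∈-surviving-++ʳ {R = b ∷ pa ∷ []} {X = (gc , c) ∷ (qd , b) ∷ []} (here refl)
    f (there (here refl)) n _ = ⊥-elim (n (there (here qb≡pc)))
    g : ∀ {u v} → (u , v) ∈ (gc , c) ∷ [] → _
    g (here refl) = ∈-surviving-++ˡ {R = b ∷ pa ∷ []} (here refl) (∉₂ S2.ga≢b S2.ga≢pc) (∉₂ S2.a≢b S2.a≢pc)

-- When pb keeps at least two parents after one cut, the other reticulated cherry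
-- survives; it is cut next, and the rewiring depends on whether pb is suppressed then.
module SharedLeafHigh {N a b pa pb ga c pc gc} (net : IsNetwork N) (ev1 : Legal N (cutKeep a b pa pb ga)) (ev2 : Legal N (cutKeep c b pc pb gc)) (a≢c : a ≢ c) where
  r1 : IsReticulatedCherry N a b pa pb
  r1 = proj₁ ev1
  r2 : IsReticulatedCherry N c b pc pb
  r2 = proj₁ ev2
  mga : (ga , pa) ∈ arcs N
  mga = proj₁ (proj₂ ev1)
  mgc : (gc , pc) ∈ arcs N
  mgc = proj₁ (proj₂ ev2)
  nt : ProperNetwork N
  nt = retCherry⇒properNetwork net r1
  eP eQ : Move
  eP = cutKeep a b pa pb ga
  eQ = cutKeep c b pc pb gc
  FP : MoveFacts N eP
  FP = moveFacts nt eP ev1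
  FQ : MoveFacts N eQ
  FQ = moveFacts nt eQ ev2
  module TP = Survivors nt eP FP
  module TQ = Survivors nt eQ FQ
  module EP = DegreeDrop nt eP FP
  module EQ = DegreeDrop nt eQ FQ
  module S1 = SharedLeaf nt r1 r2 mga a≢c
  module S2 = SharedLeaf nt r2 r1 mgc (λ e → a≢c (sym e))
  open RetCherry r1 using (ro; bo)
  pbo : outdeg N pb ≢ 0
  pbo e = 0≢1 (trans (sym e) ro)
  pb≢pa : pb ≢ pa
  pb≢pa e = S1.pa≢pb (sym e)
  pb≢pc : pb ≢ pc
  pb≢pc e = S2.pa≢pb (sym e)
  MP MQ : Graph
  MP = rewireBy N eP
  MQ = rewireBy N eQ
  inMP : indeg N pb ≡ suc (indeg MP pb)
  inMP = EP.indeg-drop pbo (∉₁ (λ e → S1.pa≢pb (sym e))) (here refl) S1.mab (λ { _ (here e) → e })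
  inMQ : indeg N pb ≡ suc (indeg MQ pb)
  inMQ = EQ.indeg-drop pbo (∉₁ (λ e → S2.pa≢pb (sym e))) (here refl) S2.mab (λ { _ (here e) → e })
  retQ : 2 ≤ indeg MQ pb → IsReticulatedCherry MQ a b pa pb
  retQ le = S1.a≢b , TQ.survivingLeaf S1.la (∉₁ S1.a≢pc) , TQ.survivingLeaf S1.lb (∉₁ S1.b≢pc) ,
    TQ.survivingArc S1.ma (∉₁ S1.pa≢pc) (∉₁ S1.a≢pc) , TQ.survivingArc S1.mb (∉₁ pb≢pc) (∉₁ S1.b≢pc) ,
    (le , EQ.outdeg≡1-survives ro S1.mb bo (∉₁ S1.b≢pc) (∉₁ pb≢pc)) , TQ.survivingArc S1.mab (∉₁ S1.pa≢pc) (∉₁ pb≢pc)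
  retP : 2 ≤ indeg MP pb → IsReticulatedCherry MP c b pc pb
  retP le = S2.a≢b , TP.survivingLeaf S2.la (∉₁ S2.a≢pc) , TP.survivingLeaf S2.lb (∉₁ S2.b≢pc) ,
    TP.survivingArc S2.ma (∉₁ S2.pa≢pc) (∉₁ S2.a≢pc) , TP.survivingArc S2.mb (∉₁ pb≢pa) (∉₁ S2.b≢pc) ,
    (le , EP.outdeg≡1-survives ro S2.mb bo (∉₁ S2.b≢pc) (∉₁ pb≢pa)) , TP.survivingArc S2.mab (∉₁ S2.pa≢pc) (∉₁ pb≢pa)

  ≤-pred-≡ : ∀ {k n m} → suc k ≤ n → n ≡ suc m → k ≤ m
  ≤-pred-≡ (s≤s le) refl = le

  sharedLeaf-indeg≥4 : 4 ≤ indeg N pb → OrchardAfter N (cut c b pc pb) → Orchard (apply N (cut a b pa pb))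
  sharedLeaf-indeg≥4 le o = closeDiamond net eP eQ eP eQ ev1 ev2 evB evA (∈-++-swap {deleted eP} {deleted eQ}) (∈-++-swap {deleted eQ} {deleted eP})
      (added-swap {eP} {eQ} okP) (added-swap {eQ} {eP} okQ) o
    where
    evB : Legal (apply N (cut c b pc pb)) eP
    evB = TQ.legal-fromRewire eP (retQ (≤-trans (n≤1+n 2) (≤-pred-≡ le inMQ)) , TQ.survivingArc mga (∉₁ S1.ga≢pc) (∉₁ S1.pa≢pc) , ≤-pred-≡ le inMQ)
    evA : Legal (apply N (cut a b pa pb)) eQ
    evA = TP.legal-fromRewire eQ (retP (≤-trans (n≤1+n 2) (≤-pred-≡ le inMP)) , TP.survivingArc mgc (∉₁ S2.ga≢pc) (∉₁ S2.pa≢pc) , ≤-pred-≡ le inMP)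
    okP : AddedSurvive eP (deleted eQ)
    okP (here refl) = ∉₁ S1.ga≢pc , ∉₁ S1.a≢pc
    okQ : AddedSurvive eQ (deleted eP)
    okQ (here refl) = ∉₁ S2.ga≢pc , ∉₁ S2.a≢pc

  sharedLeaf-indeg3 : indeg N pb ≡ 3 → OrchardAfter N (cut c b pc pb) → Orchard (apply N (cut a b pa pb))
  sharedLeaf-indeg3 i3 IH with indeg≥2⇒otherParent {MP} {pb} pc (proj₂ (MoveFacts.wellFormed-rewireBy FP)) (≤-pred-≡ (≤-reflexive (sym i3)) inMP)
  ... | x , x≢pc , mxP with rewireA⁻ {N} {pa ∷ []} {(ga , a) ∷ []} mxP
  ...   | inj₂ (here e) = ⊥-elim (S1.a≢pb (sym (cong proj₂ e)))
  ...   | inj₁ (mx , xn , _) =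
    closeDiamond net eP eQ e1' e2' ev1 ev2 evB evA r→ r← n→ n← IH
    where
    x≢pa : x ≢ pa
    x≢pa e = xn (here e)
    e1' e2' : Move
    e1' = cutSuppress a b pa pb ga x
    e2' = cutSuppress c b pc pb gc x
    i2Q : indeg MQ pb ≡ 2
    i2Q = suc-injective (trans (sym inMQ) i3)
    i2P : indeg MP pb ≡ 2
    i2P = suc-injective (trans (sym inMP) i3)
    evB : Legal (apply N (cut c b pc pb)) e1'
    evB = TQ.legal-fromRewire e1' (retQ (≤-reflexive (sym i2Q)) , TQ.survivingArc mga (∉₁ S1.ga≢pc) (∉₁ S1.pa≢pc) , i2Q ,
                      TQ.survivingArc mx (∉₁ x≢pc) (∉₁ pb≢pc) , x≢pa)
    evA : Legal (apply N (cut a b pa pb)) e2'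
    evA = TP.legal-fromRewire e2' (retP (≤-reflexive (sym i2P)) , TP.survivingArc mgc (∉₁ S2.ga≢pc) (∉₁ S2.pa≢pc) , i2P ,
                      TP.survivingArc mx (∉₁ x≢pa) (∉₁ pb≢pa) , x≢pc)
    r→ : ∀ {y} → y ∈ (pc ∷ []) ++ (pa ∷ pb ∷ []) → y ∈ (pa ∷ []) ++ (pc ∷ pb ∷ [])
    r→ = all∈⇒⊆ (there (here refl) ∷ here refl ∷ there (there (here refl)) ∷ [])
    r← : ∀ {y} → y ∈ (pa ∷ []) ++ (pc ∷ pb ∷ []) → y ∈ (pc ∷ []) ++ (pa ∷ pb ∷ [])
    r← = all∈⇒⊆ (there (here refl) ∷ here refl ∷ there (there (here refl)) ∷ [])
    n→ : ∀ {u v} → (u , v) ∈ surviving (pa ∷ pb ∷ []) ((gc , c) ∷ []) ++ (ga , a) ∷ (x , b) ∷ [] →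
                   (u , v) ∈ surviving (pc ∷ pb ∷ []) ((ga , a) ∷ []) ++ (gc , c) ∷ (x , b) ∷ []
    n→ = surviving-++-elim {R = pa ∷ pb ∷ []} {X = (gc , c) ∷ []} f g
      where
      f : ∀ {u v} → (u , v) ∈ (gc , c) ∷ [] → _ → _ → _
      f (here refl) _ _ = ∈-surviving-++ʳ {R = pc ∷ pb ∷ []} {X = (ga , a) ∷ []} (here refl)
      g : ∀ {u v} → (u , v) ∈ (ga , a) ∷ (x , b) ∷ [] → _
      g (here refl) = ∈-surviving-++ˡ {R = pc ∷ pb ∷ []} (here refl) (∉₂ S1.ga≢pc S1.ga≢pb) (∉₂ S1.a≢pc S1.a≢pb)
      g (there (here refl)) = ∈-surviving-++ʳ {R = pc ∷ pb ∷ []} {X = (ga , a) ∷ []} (there (here refl))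
    n← : ∀ {u v} → (u , v) ∈ surviving (pc ∷ pb ∷ []) ((ga , a) ∷ []) ++ (gc , c) ∷ (x , b) ∷ [] →
                   (u , v) ∈ surviving (pa ∷ pb ∷ []) ((gc , c) ∷ []) ++ (ga , a) ∷ (x , b) ∷ []
    n← = surviving-++-elim {R = pc ∷ pb ∷ []} {X = (ga , a) ∷ []} f g
      where
      f : ∀ {u v} → (u , v) ∈ (ga , a) ∷ [] → _ → _ → _
      f (here refl) _ _ = ∈-surviving-++ʳ {R = pa ∷ pb ∷ []} {X = (gc , c) ∷ []} (here refl)
      g : ∀ {u v} → (u , v) ∈ (gc , c) ∷ (x , b) ∷ [] → _
      g (here refl) = ∈-surviving-++ˡ {R = pa ∷ pb ∷ []} (here refl) (∉₂ S2.ga≢pc S2.ga≢pb) (∉₂ S2.a≢pc S2.a≢pb)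
      g (there (here refl)) = ∈-surviving-++ʳ {R = pa ∷ pb ∷ []} {X = (gc , c) ∷ []} (there (here refl))

reduceCherry-swap≈ : ∀ {N a b p q q'} (nt : ProperNetwork N) → Legal N (cherryMove a b p q) → Legal N (cherryMove b a p q') →
  Σ Relabelling λ β → reduceCherry N b a p ≈[ β ] reduceCherry N a b p
reduceCherry-swap≈ {N} {a} {b} {p} {q} {q'} nt (ch , _) ev2 =
  β , subst (λ G → reduceCherry N b a p ≈[ β ] G) swapped (apply≈ nt nt (CherrySwap.swap≈ nt ch) (cherryMove b a p q') ev2)
  where
  open Cherry ch
  β : Relabelling
  β = (idᴿ ∘ᴿ swapRelabelling a b a≢b) ∘ᴿ symᴿ idᴿ
  p≢a : p ≢ a
  p≢a = ≢-sym (NetworkFacts.leaf≢tail nt ao ma)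
  p≢b : p ≢ b
  p≢b = ≢-sym (NetworkFacts.leaf≢tail nt bo ma)
  swapped : reduceCherry N (swap a b b) (swap a b a) (swap a b p) ≡ reduceCherry N a b p
  swapped = trans (cong₂ (λ x y → reduceCherry N x y (swap a b p)) (swap-ʳ a b a≢b) (swap-ˡ a b))
                  (cong (reduceCherry N a b) (swap-≢ p≢a p≢b))

sameParentCherries : ∀ {N a b c d p q q'} → IsNetwork N → Legal N (cherryMove a b p q) → Legal N (cherryMove c d p q') →
  Orchard (reduceCherry N c d p) → Orchard (reduceCherry N a b p)
sameParentCherries {N} {a} {b} {c} {d} {p} net ev1@(ch1 , _) ev2@(ch2 , _) oQ
  with LocalFacts.cherry-children nt ch1 (Cherry.ma ch2) | LocalFacts.cherry-children nt ch1 (Cherry.mb ch2)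
  where
  nt : ProperNetwork N
  nt = cherry⇒properNetwork net ch1
... | inj₁ refl | inj₁ refl = ⊥-elim (Cherry.a≢b ch2 refl)
... | inj₂ refl | inj₂ refl = ⊥-elim (Cherry.a≢b ch2 refl)
... | inj₁ refl | inj₂ refl = oQ
... | inj₂ refl | inj₁ refl =
  orchard≈ (apply-network (reduce b a p) net ch2) (apply-network (reduce a b p) net ch1)
    (proj₂ (reduceCherry-swap≈ (cherry⇒properNetwork net ch1) ev1 ev2)) oQ

sameReticulationLeaf⇒sameParent : ∀ {N a b pa pb c pc pd} → IsNetwork N →
  IsReticulatedCherry N a b pa pb → IsReticulatedCherry N c b pc pd → pd ≡ pb
sameReticulationLeaf⇒sameParent net r1 r2 =
  NetworkFacts.leaf-uniqueParent (retCherry⇒properNetwork net r1) (RetCherry.lb r1) (RetCherry.mb r1) (RetCherry.mb r2)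

sharedReticulationLeaf : ∀ {N a b pa pb c pc} → IsNetwork N → IsReticulatedCherry N a b pa pb → IsReticulatedCherry N c b pc pb →
  (a ≢ c → Orchard (cutReticulatedCherry N pa pb)) → Orchard (cutReticulatedCherry N pc pb) → Orchard (cutReticulatedCherry N pa pb)
sharedReticulationLeaf {N} {a} {b} {pa} {pb} {c} {pc} net r1 r2 distinct oQ with ≡⊎≢ a c
... | inj₂ a≢c = distinct a≢c
... | inj₁ refl = subst (λ x → Orchard (cutReticulatedCherry N x pb)) pc≡pa oQ
  where
  pc≡pa : pc ≡ pa
  pc≡pa = NetworkFacts.leaf-uniqueParent (retCherry⇒properNetwork net r1) (RetCherry.la r1) (RetCherry.ma r1) (RetCherry.ma r2)

sharedLeaf-keep : ∀ {N a b pa pb ga c pc gc} → IsNetwork N → Legal N (cutKeep a b pa pb ga) → Legal N (cutKeep c b pc pb gc) →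
  a ≢ c → OrchardAfter N (cut c b pc pb) → Orchard (cutReticulatedCherry N pa pb)
sharedLeaf-keep net ev1@(_ , _ , i≥3) ev2 a≢c IH with 3≤⇒≡3⊎4≤ i≥3
... | inj₁ i≡3 = SharedLeafHigh.sharedLeaf-indeg3 net ev1 ev2 a≢c i≡3 IH
... | inj₂ i≥4 = SharedLeafHigh.sharedLeaf-indeg≥4 net ev1 ev2 a≢c i≥4 IH

diamond-moves : ∀ {N} → IsNetwork N → ∀ eP eQ → Legal N eP → Legal N eQ →
  Orchard (apply N (reductionOf eQ)) → OrchardAfter N (reductionOf eQ) → Orchard (apply N (reductionOf eP))
diamond-moves net eP@(cherryMove a b p q) eQ@(cherryMove c d p' q') ev1 ev2 oQ IH with ≡⊎≢ p p'
... | inj₂ p≢p' = commute-independent net eP eQ ev1 ev2 p≢p' (≢-sym p≢p') IH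
... | inj₁ refl = sameParentCherries net ev1 ev2 oQ
diamond-moves net eP@(cherryMove _ _ _ _) eQ@(cutKeep _ _ _ _ _) ev1 ev2 _ IH = commute-independent net eP eQ ev1 ev2 tt tt IH
diamond-moves net eP@(cherryMove _ _ _ _) eQ@(cutSuppress _ _ _ _ _ _) ev1 ev2 _ IH = commute-independent net eP eQ ev1 ev2 tt tt IH
diamond-moves net eP@(cutKeep _ _ _ _ _) eQ@(cherryMove _ _ _ _) ev1 ev2 _ IH = commute-independent net eP eQ ev1 ev2 tt tt IH
diamond-moves net eP@(cutSuppress _ _ _ _ _ _) eQ@(cherryMove _ _ _ _) ev1 ev2 _ IH = commute-independent net eP eQ ev1 ev2 tt tt IH
diamond-moves net eP@(cutKeep a b pa pb ga) eQ@(cutKeep c d pc pd gc) ev1@(r1 , _) ev2@(r2 , _) oQ IH with ≡⊎≢ b d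
... | inj₂ b≢d = commute-independent net eP eQ ev1 ev2 b≢d (≢-sym b≢d) IH
... | inj₁ refl with sameReticulationLeaf⇒sameParent net r1 r2
...   | refl = sharedReticulationLeaf net r1 r2 (λ a≢c → sharedLeaf-keep net ev1 ev2 a≢c IH) oQ
diamond-moves net eP@(cutKeep a b pa pb ga) eQ@(cutSuppress c d pc pd gc qd) ev1@(r1 , _ , i≥3) ev2@(r2 , _ , i≡2 , _) oQ IH with ≡⊎≢ b d
... | inj₂ b≢d = commute-independent net eP eQ ev1 ev2 b≢d (≢-sym b≢d) IH
... | inj₁ refl with sameReticulationLeaf⇒sameParent net r1 r2
...   | refl = ⊥-elim (3≰2 (subst (3 ≤_) i≡2 i≥3))
diamond-moves net eP@(cutSuppress a b pa pb ga qb) eQ@(cutKeep c d pc pd gc) ev1@(r1 , _ , i≡2 , _) ev2@(r2 , _ , i≥3) oQ IH with ≡⊎≢ b d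
... | inj₂ b≢d = commute-independent net eP eQ ev1 ev2 b≢d (≢-sym b≢d) IH
... | inj₁ refl with sameReticulationLeaf⇒sameParent net r1 r2
...   | refl = ⊥-elim (3≰2 (subst (3 ≤_) i≡2 i≥3))
diamond-moves net eP@(cutSuppress a b pa pb ga qb) eQ@(cutSuppress c d pc pd gc qd) ev1@(r1 , _) ev2@(r2 , _) oQ IH with ≡⊎≢ b d
... | inj₂ b≢d = commute-independent net eP eQ ev1 ev2 b≢d (≢-sym b≢d) IH
... | inj₁ refl with sameReticulationLeaf⇒sameParent net r1 r2
...   | refl = sharedReticulationLeaf net r1 r2 (λ a≢c → sharedLeaf-indeg2 net ev1 ev2 a≢c IH) oQ

-- The diamond property

rootCherry⇒noOtherReduction : ∀ {N c d q} → ProperNetwork N → IsCherry N c d q → indeg N q ≡ 0 →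
  ∀ P → Applicable N P → ¬ NotRootCherry N P
rootCherry⇒noOtherReduction nt ch q-root (reduce a b p) v nr with rootCherry⇒onlyRootHasChildren nt ch q-root (Cherry.ma v)
... | refl = nr refl q-root
rootCherry⇒noOtherReduction nt ch q-root (cut a b pa pb) v _
  with rootCherry⇒onlyRootHasChildren nt ch q-root (RetCherry.ma v) | rootCherry⇒onlyRootHasChildren nt ch q-root (RetCherry.mb v)
... | refl | refl = NetworkFacts.noLoop nt (RetCherry.mab v)

diamond-extensions : ∀ {N P Q} → IsNetwork N → (Σ Move λ e → (reductionOf e ≡ P) × Legal N e) → (Σ Move λ e → (reductionOf e ≡ Q) × Legal N e) →
  Orchard (apply N Q) → OrchardAfter N Q → Orchard (apply N P)
diamond-extensions net (eP , refl , evP) (eQ , refl , evQ) = diamond-moves net eP eQ evP evQ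

diamond-nonRoot : ∀ {N} → IsNetwork N → ∀ Q → Applicable N Q → Orchard (apply N Q) → OrchardAfter N Q →
  ∀ P → Applicable N P → NotRootCherry N P → Orchard (apply N P)
diamond-nonRoot {N} net (reduce c d q) vQ oQ IH P vP nr with ≡⊎≢ (indeg N q) 0
... | inj₁ q-root = ⊥-elim (rootCherry⇒noOtherReduction (cherry⇒properNetwork net vQ) vQ q-root P vP nr)
... | inj₂ q-nonRoot =
  diamond-extensions net (extendToMove nt P vP nr) (extendToMove nt (reduce c d q) vQ (λ { refl → q-nonRoot })) oQ IH
  where
  nt : ProperNetwork N
  nt = cherry⇒properNetwork net vQ
diamond-nonRoot {N} net (cut c d pc pd) vQ oQ IH P vP nr =
  diamond-extensions net (extendToMove nt P vP nr) (extendToMove nt (cut c d pc pd) vQ (λ ())) oQ IH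
  where
  nt : ProperNetwork N
  nt = retCherry⇒properNetwork net vQ

diamond : ∀ {N} → IsNetwork N → ∀ Q → Applicable N Q → Orchard (apply N Q) → OrchardAfter N Q → ∀ P → Applicable N P → Orchard (apply N P)
diamond {N} net Q vQ oQ IH (reduce a b p) vP with ≡⊎≢ (indeg N p) 0
... | inj₁ e = subst Orchard (sym (reduceCherry-root N a b p e)) (done _ (a , refl , refl))
... | inj₂ np = diamond-nonRoot net Q vQ oQ IH (reduce a b p) vP (λ { refl → np })
diamond {N} net Q vQ oQ IH (cut a b pa pb) vP = diamond-nonRoot net Q vQ oQ IH (cut a b pa pb) vP (λ ())

orchard-apply : ∀ {N} → Orchard N → IsNetwork N → ∀ m → Applicable N m → Orchard (apply N m)
orchard-apply (done N (x , eV , eA)) net m v with applicable⇒arc m v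
... | _ , am rewrite eA with am
... | ()
orchard-apply (cherry N c d q vc o) net m v =
  diamond net (reduce c d q) vc o (λ m' v' → orchard-apply o (apply-network (reduce c d q) net vc) m' v') m v
orchard-apply (retCut N c d pc pd vr o) net m v =
  diamond net (cut c d pc pd) vr o (λ m' v' → orchard-apply o (apply-network (cut c d pc pd) net vr) m' v') m v

stackFreeOrchard-apply : ∀ {N} → StackFreeOrchardNetwork N → ∀ m → Applicable N m → StackFreeOrchardNetwork (apply N m)
stackFreeOrchard-apply {N} (net , sf , orch) m v = proj₁ inherited , proj₂ inherited sf , orchard-apply orch net m v
  where
  inherited : Inherits N (apply N m)
  inherited = apply-inherits net m v

lemma5p2 : (N : Graph) → StackFreeOrchardNetwork N →
    (∀ a b p → IsCherry N a b p →
       StackFreeOrchardNetwork (reduceCherry N a b p))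
    × (∀ a b pa pb → IsReticulatedCherry N a b pa pb →
       StackFreeOrchardNetwork (cutReticulatedCherry N pa pb))
lemma5p2 N sfo =
  (λ a b p → stackFreeOrchard-apply sfo (reduce a b p)) ,
  (λ a b pa pb → stackFreeOrchard-apply sfo (cut a b pa pb))
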